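{- Let $G$ be a finite simple graph and let $D$ be an orientation of $G$. For each $v\in V(G)$, let $L(v)$ be a set of $d^+_D(v)+1$ positive integers. If $EE(\mathcal{W}(D))\neq EO(\mathcal{W}(D))$, then there is an additive coloring $\ell:V(G)\rightarrow \mathbb{N}$ of $G$ such that $\ell(v)\in L(v)$ for each $v\in V(G)$.
   Context: $\mathbb{N}$ denotes the positive integers. An additive coloring of a graph $G$ is a function $\ell:V(G)\to\mathbb{N}$ such that $c(v)=\sum_{u\in N_G(v)}\ell(u)$ defines a proper coloring, i.e. $c(u)\neq c(v)$ whenever $\{u,v\}\in E(G)$. For a digraph $D$, $d^+_D(v)$, $d^-_D(v)$ are out- and in-degree, $N_D(v)$ is the set of vertices joined to $v$ by an arc in either direction, $N_D[v]=N_D(v)\cup\{v\}$, and $U\triangle V=(U\setminus V)\cup(V\setminus U)$. A digraph is Eulerian if $d^+(v)=d^-(v)$ at every vertex (connectivity not required). A spanning subdigraph has the same vertex set. $EE(H)$ (resp. $EO(H)$) is the number of spanning Eulerian subdigraphs of $H$ with an even (resp. odd) number of arcs; the arcless spanning subdigraph counts as even. The digraph $\mathcal{W}(D)$: for each arc $vw$ of $D$ create new vertices $x^{vw}$ for every $x\in N_D(v)\triangle N_D(w)$ and $y^{vw}_x$ for every $x\in N_D(w)\setminus N_D[v]$, with arcs $v^{vw}\to x^{vw}$ for $x\in N_D(v)\setminus N_D(w)$ and arcs $v^{vw}\to y^{vw}_x$, $y^{vw}_x\to x^{vw}$ for $x\in N_D(w)\setminus N_D[v]$ (this is the $vw$-sector;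 sectors for distinct arcs are vertex-disjoint). Additionally add a vertex $x^*$ for each $x\in V(D)$, an arc $v^*\to v^{vw}$ for each arc $vw$ of $D$, and an arc $x^{vw}\to x^*$ for each vertex $x^{vw}$ with $x\neq v$. $\mathcal{W}(D)$ consists of all these vertices and arcs. -}

module Defs where

open import Data.Nat using (ℕ; zero; suc; _+_; _<_)
open import Data.Nat.Base using (_%_)
open import Data.Bool using (Bool; true; false; _∧_; _∨_; not; if_then_else_)
open import Data.Fin using (Fin)
open import Data.Fin.Properties using (_≟_)
open import Data.Nat.Properties using () renaming (_≟_ to _≟ℕ_)
open import Data.Bool.Properties using () renaming (_≟_ to _≟B_)
open import Data.List using (List; []; _∷_; _++_; length; map; concatMap; allFin; filter)
open import Data.Nat.ListAction using (sum)
open import Data.List.Membership.Propositional using (_∈_)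
open import Data.List.Relation.Unary.All using (All)
open import Data.List.Relation.Unary.Unique.Propositional using (Unique)
open import Data.Sum using (_⊎_)
open import Data.Product using (_×_; _,_; proj₁; proj₂)
open import Relation.Nullary.Decidable using (⌊_⌋)
open import Relation.Binary.PropositionalEquality using (_≡_; _≢_)

count : {A : Set} → (A → Bool) → List A → ℕ
count p []       = 0
count p (x ∷ xs) = if p x then suc (count p xs) else count p xs

-- all sublists (each position kept or dropped): the 2^m arc subsets
sublists : {A : Set} → List A → List (List A)
sublists []       = [] ∷ []
sublists (x ∷ xs) = let r = sublists xs in r ++ map (x ∷_) r

allB : {A : Set} → (A → Bool) → List A → Bool
allB p []       = true
allB p (x ∷ xs) = p x ∧ allB p xs

_==_ : {n : ℕ} → Fin n → Fin n → Bool
x == y = ⌊ x ≟ y ⌋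

isEven : ℕ → Bool
isEven zero          = true
isEven (suc zero)    = false
isEven (suc (suc k)) = isEven k

record SimpleGraph (n : ℕ) : Set where
  field
    E     : Fin n → Fin n → Bool
    sym   : ∀ u v → E u v ≡ E v u
    irrefl : ∀ v → E v v ≡ false
open SimpleGraph public

record Orientation {n : ℕ} (G : SimpleGraph n) : Set where
  field
    A       : Fin n → Fin n → Bool
    arc⇒edge : ∀ u v → A u v ≡ true → E G u v ≡ true
    edge⇒arc : ∀ u v → E G u v ≡ true → (A u v ≡ true) ⊎ (A v u ≡ true)
    antisym  : ∀ u v → A u v ≡ true → A v u ≡ false
open Orientation public

module _ {n : ℕ} where
  outdeg : (Fin n → Fin n → Bool) → Fin n → ℕ
  outdeg A v = count (A v) (allFin n)

  nbr : (Fin n → Fin n → Bool) → Fin n → Fin n → Bool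
  nbr A v x = A v x ∨ A x v

-- Vertex type of W(D).  star x = x^* ; sec v w x = x^{vw} ;
-- ysec v w x = y^{vw}_x.  The type contains all index triples; those
-- not corresponding to actual vertices of W(D) are isolated (no arcs)
-- and do not affect the Eulerian subdigraph counts.
data WV (n : ℕ) : Set where
  star : Fin n → WV n
  sec  : Fin n → Fin n → Fin n → WV n
  ysec : Fin n → Fin n → Fin n → WV n

eqWV : {n : ℕ} → WV n → WV n → Bool
eqWV (star x) (star y) = x == y
eqWV (sec a b c) (sec a' b' c') = (a == a') ∧ (b == b') ∧ (c == c')
eqWV (ysec a b c) (ysec a' b' c') = (a == a') ∧ (b == b') ∧ (c == c')
eqWV _ _ = false

allWV : (n : ℕ) → List (WV n)
allWV n = map star (allFin n)
  ++ concatMap (λ a → concatMap (λ b → concatMap (λ c → sec a b c ∷ ysec a b c ∷ []) (allFin n)) (allFin n)) (allFin n)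

Arc : ℕ → Set
Arc n = WV n × WV n

guard : {B : Set} → Bool → List B → List B
guard true  xs = xs
guard false _  = []

sectorArcs : {n : ℕ} → (Fin n → Fin n → Bool) → Fin n → Fin n → List (Arc n)
sectorArcs {n} A v w =
  (star v , sec v w v) ∷
  concatMap (λ x →
      -- x ∈ N(v) \ N(w)   (then x ≠ v automatically)
      guard (nbr A v x ∧ not (nbr A w x))
        ((sec v w v , sec v w x) ∷ (sec v w x , star x) ∷ [])
   ++
      guard (nbr A w x ∧ not (nbr A v x) ∧ not (x == v))
        ((sec v w v , ysec v w x) ∷ (ysec v w x , sec v w x) ∷ (sec v w x , star x) ∷ []))
    (allFin n)

W : {n : ℕ} → (Fin n → Fin n → Bool) → List (Arc n)
W {n} A = concatMap (λ v → concatMap (λ w → guard (A v w) (sectorArcs A v w)) (allFin n)) (allFin n)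

outD inD : {n : ℕ} → List (Arc n) → WV n → ℕ
outD S u = count (λ a → eqWV (proj₁ a) u) S
inD  S u = count (λ a → eqWV (proj₂ a) u) S

isEulerian : {n : ℕ} → List (Arc n) → Bool
isEulerian {n} S = allB (λ u → ⌊ outD S u ≟ℕ inD S u ⌋) (allWV n)

-- EE(H), EO(H) for the digraph H with arc list H (all arcs distinct)
EE EO : {n : ℕ} → List (Arc n) → ℕ
EE H = count (λ S → isEulerian S ∧ isEven (length S)) (sublists H)
EO H = count (λ S → isEulerian S ∧ not (isEven (length S))) (sublists H)

colorSum : {n : ℕ} → SimpleGraph n → (Fin n → ℕ) → Fin n → ℕ
colorSum {n} G ℓ v = sum (map ℓ (filter (λ u → E G v u ≟B true) (allFin n)))

IsAdditiveColoring : {n : ℕ} → SimpleGraph n → (Fin n → ℕ) → Set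
IsAdditiveColoring {n} G ℓ =
  (∀ v → 0 < ℓ v) ×
  (∀ u v → E G u v ≡ true → colorSum G ℓ u ≢ colorSum G ℓ v)

-- A spanning Eulerian subdigraph of W(D) meets each vw-sector either not at all or in
-- v^* → v^{vw} followed by one path v^{vw} → … → x^* (of length 2 if x ∈ N(v) \ N(w),
-- of length 3 if x ∈ N(w) \ N[v]).  Contracting every sector to one arc v^* → x^* of
-- weight [x ∈ N(v)] - [x ∈ N(w)] (the loop x = v standing for the empty choice) turns
-- EE - EO into ± the coefficient of ∏_v X_v ^ d⁺(v) in P = ∏_{vw ∈ D} (c(v) - c(w)),
-- where c(v) = ∑_{x ∈ N(v)} X_x.  As deg P = |D| = ∑_v d⁺(v), the Combinatorial
-- Nullstellensatz, proved here through iterated divided differences on the lists L(v),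
-- yields ℓ(v) ∈ L(v) with P(ℓ) ≠ 0, i.e. c(u) ≠ c(v) along every edge.
module Submission where

open import Defs hiding (sym)

open import Data.Bool using (Bool; true; false; _∧_; not; if_then_else_)
import Data.Bool.Properties as BP
open import Data.Empty using (⊥; ⊥-elim)
open import Data.Fin using (Fin)
import Data.Fin as F
open import Data.Integer using (ℤ)
import Data.Integer as Z
import Data.Integer.Properties as ZP
import Data.Integer.Solver
open import Data.List
  using (List; []; _∷_; _++_; length; map; concatMap; allFin; filter; cartesianProduct)
import Data.List.Properties as LP
open import Data.List.Membership.Propositional using (_∈_; lose)
open import Data.List.Membership.Propositional.Properties
  using (∈-allFin; ∈-++⁺ˡ; ∈-++⁺ʳ; ∈-map⁺; ∈-concatMap⁺; ∈-filter⁺; ∈-cartesianProduct⁺)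
open import Data.List.Relation.Unary.All using (All)
import Data.List.Relation.Unary.All as All
import Data.List.Relation.Unary.All.Properties as AllP
open import Data.List.Relation.Unary.AllPairs using (_∷_)
open import Data.List.Relation.Unary.Any using (here; there)
open import Data.List.Relation.Unary.Unique.Propositional using (Unique)
import Data.List.Relation.Unary.Unique.Propositional.Properties as UP
open import Data.Nat using (ℕ; zero; suc; _<_; _≤_; s≤s; _≡ᵇ_)
import Data.Nat as N
open import Data.Nat.ListAction using (sum)
import Data.Nat.Properties as NP
open import Data.Product using (Σ; _×_; _,_; proj₁; proj₂)
open import Data.Rational using (ℚ; 0ℚ; 1ℚ; _+_; _*_; -_; _-_; 1/_; ≢-nonZero)
import Data.Rational as Q
open import Data.Rational.Properties using (≤-refl; <⇒≤; <-irrefl; +-mono-<-≤)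
import Data.Rational.Properties as QP
open import Data.Rational.Solver using (module +-*-Solver)
open import Data.Sum using (_⊎_; inj₁; inj₂; [_,_]′)
open import Data.Vec.Functional using (foldr; updateAt) renaming ([] to []ᵛ; _∷_ to _∷ᵛ_)
open import Data.Vec.Functional.Properties using (updateAt-updates; updateAt-minimal)
open import Function using (_∘_)
open import Relation.Binary.PropositionalEquality
  using (_≡_; _≢_; refl; sym; trans; cong; cong₂; subst; ≢-sym; module ≡-Reasoning)
open import Relation.Nullary using (yes; no)
open import Relation.Nullary.Decidable using (⌊_⌋; toWitness)
open import Relation.Unary using (Decidable)

open import Algebra.Properties.Group QP.+-0-group using (∙-cancelˡ; x∙y⁻¹≈ε⇒x≈y)
open ≡-Reasoning
open +-*-Solver using (solve; _:=_; _:+_; _:*_; _:-_; :-_; con)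
module ZS = Data.Integer.Solver.+-*-Solver

∑ : {A : Set} → List A → (A → ℚ) → ℚ
∑ []       f = 0ℚ
∑ (x ∷ xs) f = f x + ∑ xs f

syntax ∑ xs (λ x → e) = ∑[ x ← xs ] e

∏ : {A : Set} → List A → (A → ℚ) → ℚ
∏ []       f = 1ℚ
∏ (x ∷ xs) f = f x * ∏ xs f

syntax ∏ xs (λ x → e) = ∏[ x ← xs ] e

module _ {A : Set} where

  ∑-cong : (xs : List A) {f g : A → ℚ} → (∀ x → f x ≡ g x) → ∑ xs f ≡ ∑ xs g
  ∑-cong []       f≗g = refl
  ∑-cong (x ∷ xs) f≗g = cong₂ _+_ (f≗g x) (∑-cong xs f≗g)

  ∑-zero : (xs : List A) {f : A → ℚ} → (∀ {x} → x ∈ xs → f x ≡ 0ℚ) → ∑ xs f ≡ 0ℚ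
  ∑-zero []       f≗0 = refl
  ∑-zero (x ∷ xs) f≗0 = cong₂ _+_ (f≗0 (here refl)) (∑-zero xs (f≗0 ∘ there))

  ∑-+ : (xs : List A) (f g : A → ℚ) → ∑[ x ← xs ] (f x + g x) ≡ ∑ xs f + ∑ xs g
  ∑-+ []       f g = refl
  ∑-+ (x ∷ xs) f g = begin
      (f x + g x) + ∑[ y ← xs ] (f y + g y)
    ≡⟨ cong ((f x + g x) +_) (∑-+ xs f g) ⟩
      (f x + g x) + (∑ xs f + ∑ xs g)
    ≡⟨ solve 4 (λ a b c d → (a :+ b) :+ (c :+ d) := (a :+ c) :+ (b :+ d)) refl (f x) (g x) (∑ xs f) (∑ xs g) ⟩
      (f x + ∑ xs f) + (g x + ∑ xs g) ∎

  ∑-*ˡ : (xs : List A) (c : ℚ) (f : A → ℚ) → ∑[ x ← xs ] (c * f x) ≡ c * ∑ xs f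
  ∑-*ˡ []       c f = sym (QP.*-zeroʳ c)
  ∑-*ˡ (x ∷ xs) c f =
    trans (cong (c * f x +_) (∑-*ˡ xs c f)) (sym (QP.*-distribˡ-+ c (f x) (∑ xs f)))

  ∑-*ʳ : (xs : List A) (f : A → ℚ) (c : ℚ) → ∑[ x ← xs ] (f x * c) ≡ ∑ xs f * c
  ∑-*ʳ xs f c = begin
    ∑[ x ← xs ] (f x * c)  ≡⟨ ∑-cong xs (λ x → QP.*-comm (f x) c) ⟩
    ∑[ x ← xs ] (c * f x)  ≡⟨ ∑-*ˡ xs c f ⟩
    c * ∑ xs f             ≡⟨ QP.*-comm c _ ⟩
    ∑ xs f * c             ∎

  ∑-neg : (xs : List A) (f : A → ℚ) → ∑[ x ← xs ] (- f x) ≡ - ∑ xs f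
  ∑-neg []       f = refl
  ∑-neg (x ∷ xs) f = trans (cong (- f x +_) (∑-neg xs f)) (sym (QP.neg-distrib-+ (f x) _))

  ∑-++ : (xs ys : List A) (f : A → ℚ) → ∑ (xs ++ ys) f ≡ ∑ xs f + ∑ ys f
  ∑-++ []       ys f = sym (QP.+-identityˡ _)
  ∑-++ (x ∷ xs) ys f = trans (cong (f x +_) (∑-++ xs ys f)) (sym (QP.+-assoc (f x) _ _))

  ∑-map : {B : Set} (g : A → B) (xs : List A) (f : B → ℚ) → ∑ (map g xs) f ≡ ∑ xs (f ∘ g)
  ∑-map g []       f = refl
  ∑-map g (x ∷ xs) f = cong (f (g x) +_) (∑-map g xs f)

  ∏-nonZero : (xs : List A) (f : A → ℚ) → ∏ xs f ≢ 0ℚ → ∀ {x} → x ∈ xs → f x ≢ 0ℚ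
  ∏-nonZero (y ∷ xs) f ∏≢0 (here refl) fy≡0 = ∏≢0 (trans (cong (_* ∏ xs f) fy≡0) (QP.*-zeroˡ (∏ xs f)))
  ∏-nonZero (y ∷ xs) f ∏≢0 (there x∈xs) =
    ∏-nonZero xs f (λ ∏xs≡0 → ∏≢0 (trans (cong (f y *_) ∏xs≡0) (QP.*-zeroʳ (f y)))) x∈xs

==-refl : ∀ {n} (x : Fin n) → (x == x) ≡ true
==-refl x with x F.≟ x
... | yes _  = refl
... | no x≢x = ⊥-elim (x≢x refl)

==-≢ : ∀ {n} {x y : Fin n} → x ≢ y → (x == y) ≡ false
==-≢ {x = x} {y} x≢y with x F.≟ y
... | yes x≡y = ⊥-elim (x≢y x≡y)
... | no _    = refl

∑-indicator : ∀ {n} {xs : List (Fin n)} {v} (a : ℚ) → Unique xs → v ∈ xs →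
              ∑[ x ← xs ] (if x == v then a else 0ℚ) ≡ a
∑-indicator {xs = x ∷ xs} a (x∉xs ∷ _) (here refl) rewrite ==-refl x = trans
  (cong (a +_) (∑-zero xs (λ y∈xs → cong (if_then a else 0ℚ) (==-≢ (≢-sym (All.lookup x∉xs y∈xs))))))
  (QP.+-identityʳ a)
∑-indicator {xs = x ∷ xs} {v} a (x∉xs ∷ u) (there v∈xs) rewrite ==-≢ (All.lookup x∉xs v∈xs) = trans
  (QP.+-identityˡ _) (∑-indicator a u v∈xs)

ι : ℕ → ℚ
ι zero    = 0ℚ
ι (suc n) = 1ℚ + ι n

ι-+ : ∀ m n → ι (m N.+ n) ≡ ι m + ι n
ι-+ zero    n = sym (QP.+-identityˡ (ι n))
ι-+ (suc m) n = trans (cong (1ℚ +_) (ι-+ m n)) (sym (QP.+-assoc 1ℚ (ι m) (ι n)))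

0<ι-suc : ∀ n → 0ℚ Q.< ι (suc n)
0≤ι : ∀ n → 0ℚ Q.≤ ι n

0<ι-suc n = +-mono-<-≤ (toWitness {a? = 0ℚ QP.<? 1ℚ} _) (0≤ι n)

0≤ι zero    = ≤-refl
0≤ι (suc n) = <⇒≤ (0<ι-suc n)

ι-suc≢0 : ∀ n → ι (suc n) ≢ 0ℚ
ι-suc≢0 n ι≡0 = <-irrefl (sym ι≡0) (0<ι-suc n)

ι-injective : ∀ m n → ι m ≡ ι n → m ≡ n
ι-injective zero    zero    _ = refl
ι-injective zero    (suc n) e = ⊥-elim (ι-suc≢0 n (sym e))
ι-injective (suc m) zero    e = ⊥-elim (ι-suc≢0 m e)
ι-injective (suc m) (suc n) e = cong suc (ι-injective m n (∙-cancelˡ 1ℚ (ι m) (ι n) e))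

ι-≢⇒-≢0 : ∀ {m n} → m ≢ n → ι m - ι n ≢ 0ℚ
ι-≢⇒-≢0 {m} {n} m≢n e = m≢n (ι-injective m n (x∙y⁻¹≈ε⇒x≈y (ι m) (ι n) e))

-- A total inverse with 0 ⁻¹ = 0; abstract, so that normalisation never unfolds it.
abstract
  infix 9 _⁻¹

  _⁻¹ : ℚ → ℚ
  p ⁻¹ with p Q.≟ 0ℚ
  ... | yes _  = 0ℚ
  ... | no p≢0 = (1/ p) {{≢-nonZero p≢0}}

  ⁻¹-inverseˡ : ∀ p → p ≢ 0ℚ → p ⁻¹ * p ≡ 1ℚ
  ⁻¹-inverseˡ p p≢0 with p Q.≟ 0ℚ
  ... | yes p≡0 = ⊥-elim (p≢0 p≡0)
  ... | no p≢0′ = QP.*-inverseˡ p {{≢-nonZero p≢0′}}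

  0⁻¹ : 0ℚ ⁻¹ ≡ 0ℚ
  0⁻¹ = refl

⁻¹-inverseʳ : ∀ p → p ≢ 0ℚ → p * p ⁻¹ ≡ 1ℚ
⁻¹-inverseʳ p p≢0 = trans (QP.*-comm p (p ⁻¹)) (⁻¹-inverseˡ p p≢0)

*-⁻¹-cancelʳ : ∀ x p → p ≢ 0ℚ → (x * p) * p ⁻¹ ≡ x
*-⁻¹-cancelʳ x p p≢0 = begin
  (x * p) * p ⁻¹  ≡⟨ QP.*-assoc x p (p ⁻¹) ⟩
  x * (p * p ⁻¹)  ≡⟨ cong (x *_) (⁻¹-inverseʳ p p≢0) ⟩
  x * 1ℚ          ≡⟨ QP.*-identityʳ x ⟩
  x               ∎

*-cancelʳ-≡0 : ∀ x p → p ≢ 0ℚ → x * p ≡ 0ℚ → x ≡ 0ℚ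
*-cancelʳ-≡0 x p p≢0 xp≡0 = begin
  x               ≡⟨ sym (*-⁻¹-cancelʳ x p p≢0) ⟩
  (x * p) * p ⁻¹  ≡⟨ cong (_* p ⁻¹) xp≡0 ⟩
  0ℚ * p ⁻¹       ≡⟨ QP.*-zeroˡ (p ⁻¹) ⟩
  0ℚ              ∎

⁻¹-unique : ∀ x y → x * y ≡ 1ℚ → x ⁻¹ ≡ y
⁻¹-unique x y xy≡1 = begin
  x ⁻¹             ≡⟨ sym (QP.*-identityʳ _) ⟩
  x ⁻¹ * 1ℚ        ≡⟨ cong (x ⁻¹ *_) (sym xy≡1) ⟩
  x ⁻¹ * (x * y)   ≡⟨ sym (QP.*-assoc (x ⁻¹) x y) ⟩
  (x ⁻¹ * x) * y   ≡⟨ cong (_* y) (⁻¹-inverseˡ x x≢0) ⟩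
  1ℚ * y           ≡⟨ QP.*-identityˡ y ⟩
  y                ∎
  where
  x≢0 : x ≢ 0ℚ
  x≢0 refl with trans (sym xy≡1) (QP.*-zeroˡ y)
  ... | ()

⁻¹-1 : 1ℚ ⁻¹ ≡ 1ℚ
⁻¹-1 = ⁻¹-unique 1ℚ 1ℚ refl

⁻¹-distrib-* : ∀ p q → (p * q) ⁻¹ ≡ p ⁻¹ * q ⁻¹
⁻¹-distrib-* p q with p Q.≟ 0ℚ | q Q.≟ 0ℚ
... | yes refl | _ = begin
  (0ℚ * q) ⁻¹      ≡⟨ cong _⁻¹ (QP.*-zeroˡ q) ⟩
  0ℚ ⁻¹            ≡⟨ 0⁻¹ ⟩
  0ℚ               ≡⟨ sym (QP.*-zeroˡ (q ⁻¹)) ⟩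
  0ℚ * q ⁻¹        ≡⟨ cong (_* q ⁻¹) (sym 0⁻¹) ⟩
  0ℚ ⁻¹ * q ⁻¹     ∎
... | no _ | yes refl = begin
  (p * 0ℚ) ⁻¹      ≡⟨ cong _⁻¹ (QP.*-zeroʳ p) ⟩
  0ℚ ⁻¹            ≡⟨ 0⁻¹ ⟩
  0ℚ               ≡⟨ sym (QP.*-zeroʳ (p ⁻¹)) ⟩
  p ⁻¹ * 0ℚ        ≡⟨ cong (p ⁻¹ *_) (sym 0⁻¹) ⟩
  p ⁻¹ * 0ℚ ⁻¹     ∎
... | no p≢0 | no q≢0 = ⁻¹-unique (p * q) (p ⁻¹ * q ⁻¹) (begin
  (p * q) * (p ⁻¹ * q ⁻¹)
    ≡⟨ solve 4 (λ a b c d → (a :* b) :* (c :* d) := (a :* c) :* (b :* d)) refl p q (p ⁻¹) (q ⁻¹) ⟩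
  (p * p ⁻¹) * (q * q ⁻¹)
    ≡⟨ cong₂ _*_ (⁻¹-inverseʳ p p≢0) (⁻¹-inverseʳ q q≢0) ⟩
  1ℚ ∎)

⁻¹-neg : ∀ p → (- p) ⁻¹ ≡ - p ⁻¹
⁻¹-neg p with p Q.≟ 0ℚ
... | yes refl = trans 0⁻¹ (cong -_ (sym 0⁻¹))
... | no p≢0 = ⁻¹-unique (- p) (- p ⁻¹)
  (trans (solve 2 (λ a b → (:- a) :* (:- b) := a :* b) refl p (p ⁻¹)) (⁻¹-inverseʳ p p≢0))

-- Divided differences

infixr 8 _^_

_^_ : ℚ → ℕ → ℚ
x ^ zero  = 1ℚ
x ^ suc e = x * x ^ e

δ : ℕ → ℕ → ℚ
δ e k = if e ≡ᵇ k then 1ℚ else 0ℚ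

δ-refl : ∀ e → δ e e ≡ 1ℚ
δ-refl zero    = refl
δ-refl (suc e) = δ-refl e

δ-< : ∀ {e k} → e < k → δ e k ≡ 0ℚ
δ-< {zero}  {suc k} _         = refl
δ-< {suc e} {suc k} (s≤s e<k) = δ-< e<k

-- The divided difference of f at the nodes ι L, i.e. ∑_{t ∈ L} f t / ∏_{u ∈ L, u ≠ t} (ι t - ι u).
divDiff : List ℕ → (ℕ → ℚ) → ℚ
divDiff []      f = 0ℚ
divDiff (a ∷ L) f = f a * (∏[ u ← L ] (ι a - ι u)) ⁻¹ + divDiff L (λ t → f t * (ι t - ι a) ⁻¹)

divDiff-cong : ∀ L {f g : ℕ → ℚ} → (∀ t → t ∈ L → f t ≡ g t) → divDiff L f ≡ divDiff L g
divDiff-cong []      f≗g = refl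
divDiff-cong (a ∷ L) f≗g = cong₂ _+_
  (cong (_* _) (f≗g a (here refl)))
  (divDiff-cong L (λ t t∈L → cong (_* (ι t - ι a) ⁻¹) (f≗g t (there t∈L))))

divDiff-+ : ∀ L (f g : ℕ → ℚ) → divDiff L (λ t → f t + g t) ≡ divDiff L f + divDiff L g
divDiff-+ []      f g = refl
divDiff-+ (a ∷ L) f g = begin
    (f a + g a) * i + divDiff L (λ t → (f t + g t) * (ι t - ι a) ⁻¹)
  ≡⟨ cong ((f a + g a) * i +_) (trans
       (divDiff-cong L (λ t _ → QP.*-distribʳ-+ ((ι t - ι a) ⁻¹) (f t) (g t)))
       (divDiff-+ L _ _)) ⟩
    (f a + g a) * i + (F + G)
  ≡⟨ solve 5 (λ x y i u v → (x :+ y) :* i :+ (u :+ v) := (x :* i :+ u) :+ (y :* i :+ v)) refl (f a) (g a) i F G ⟩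
    (f a * i + F) + (g a * i + G) ∎
  where
  i = (∏[ u ← L ] (ι a - ι u)) ⁻¹
  F = divDiff L (λ t → f t * (ι t - ι a) ⁻¹)
  G = divDiff L (λ t → g t * (ι t - ι a) ⁻¹)

divDiff-*ˡ : ∀ L (c : ℚ) (f : ℕ → ℚ) → divDiff L (λ t → c * f t) ≡ c * divDiff L f
divDiff-*ˡ []      c f = sym (QP.*-zeroʳ c)
divDiff-*ˡ (a ∷ L) c f = begin
    c * f a * i + divDiff L (λ t → c * f t * (ι t - ι a) ⁻¹)
  ≡⟨ cong (c * f a * i +_) (trans (divDiff-cong L (λ t _ → QP.*-assoc c (f t) _)) (divDiff-*ˡ L c _)) ⟩
    c * f a * i + c * F
  ≡⟨ solve 4 (λ c x i u → c :* x :* i :+ c :* u := c :* (x :* i :+ u)) refl c (f a) i F ⟩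
    c * (f a * i + F) ∎
  where
  i = (∏[ u ← L ] (ι a - ι u)) ⁻¹
  F = divDiff L (λ t → f t * (ι t - ι a) ⁻¹)

divDiff-*ʳ : ∀ L (f : ℕ → ℚ) (c : ℚ) → divDiff L (λ t → f t * c) ≡ divDiff L f * c
divDiff-*ʳ L f c = begin
  divDiff L (λ t → f t * c)  ≡⟨ divDiff-cong L (λ t _ → QP.*-comm (f t) c) ⟩
  divDiff L (λ t → c * f t)  ≡⟨ divDiff-*ˡ L c f ⟩
  c * divDiff L f            ≡⟨ QP.*-comm c _ ⟩
  divDiff L f * c            ∎

divDiff-- : ∀ L (f g : ℕ → ℚ) → divDiff L (λ t → f t - g t) ≡ divDiff L f - divDiff L g
divDiff-- L f g = begin
    divDiff L (λ t → f t - g t)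
  ≡⟨ divDiff-cong L (λ t _ → solve 2 (λ x y → x :- y := x :+ (:- con 1ℚ) :* y) refl (f t) (g t)) ⟩
    divDiff L (λ t → f t + (- 1ℚ) * g t)
  ≡⟨ divDiff-+ L f _ ⟩
    divDiff L f + divDiff L (λ t → (- 1ℚ) * g t)
  ≡⟨ cong (divDiff L f +_) (trans (divDiff-*ˡ L (- 1ℚ) g) (solve 1 (λ x → (:- con 1ℚ) :* x := :- x) refl _)) ⟩
    divDiff L f - divDiff L g ∎

divDiff-zero : ∀ L {f : ℕ → ℚ} → (∀ t → t ∈ L → f t ≡ 0ℚ) → divDiff L f ≡ 0ℚ
divDiff-zero L {f} f≗0 = begin
  divDiff L f               ≡⟨ divDiff-cong L (λ t t∈L → trans (f≗0 t t∈L) (sym (QP.*-zeroˡ 0ℚ))) ⟩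
  divDiff L (λ _ → 0ℚ * 0ℚ) ≡⟨ divDiff-*ˡ L 0ℚ (λ _ → 0ℚ) ⟩
  0ℚ * divDiff L (λ _ → 0ℚ) ≡⟨ QP.*-zeroˡ (divDiff L (λ _ → 0ℚ)) ⟩
  0ℚ                        ∎

divDiff≢0⇒witness : ∀ L (f : ℕ → ℚ) → divDiff L f ≢ 0ℚ → Σ ℕ (λ t → t ∈ L × f t ≢ 0ℚ)
divDiff≢0⇒witness []      f D≢0 = ⊥-elim (D≢0 refl)
divDiff≢0⇒witness (a ∷ L) f D≢0 with f a Q.≟ 0ℚ
... | no fa≢0 = a , here refl , fa≢0
... | yes fa≡0 with divDiff≢0⇒witness L (λ t → f t * (ι t - ι a) ⁻¹) D′≢0
  where
  D′≢0 : divDiff L (λ t → f t * (ι t - ι a) ⁻¹) ≢ 0ℚ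
  D′≢0 D′≡0 = D≢0 (cong₂ _+_ (trans (cong (_* i) fa≡0) (QP.*-zeroˡ i)) D′≡0)
    where i = (∏[ u ← L ] (ι a - ι u)) ⁻¹
...   | t , t∈L , ft/≢0 = t , there t∈L , λ ft≡0 → ft/≢0 (trans (cong (_* i) ft≡0) (QP.*-zeroˡ i))
  where i = (ι t - ι a) ⁻¹

divDiff-shift : ∀ a L (g : ℕ → ℚ) → All (a ≢_) L →
                divDiff (a ∷ L) (λ t → g t * (ι t - ι a)) ≡ divDiff L g
divDiff-shift a L g a∉L = begin
    g a * (ι a - ι a) * i + divDiff L (λ t → g t * (ι t - ι a) * (ι t - ι a) ⁻¹)
  ≡⟨ cong₂ _+_ vanish (divDiff-cong L (λ t t∈L →
       *-⁻¹-cancelʳ (g t) (ι t - ι a) (ι-≢⇒-≢0 (≢-sym (All.lookup a∉L t∈L))))) ⟩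
    0ℚ + divDiff L g
  ≡⟨ QP.+-identityˡ _ ⟩
    divDiff L g ∎
  where
  i = (∏[ u ← L ] (ι a - ι u)) ⁻¹
  vanish : g a * (ι a - ι a) * i ≡ 0ℚ
  vanish = begin
    g a * (ι a - ι a) * i  ≡⟨ cong (λ z → g a * z * i) (QP.+-inverseʳ (ι a)) ⟩
    g a * 0ℚ * i           ≡⟨ cong (_* i) (QP.*-zeroʳ (g a)) ⟩
    0ℚ * i                 ≡⟨ QP.*-zeroˡ i ⟩
    0ℚ                     ∎

⁻¹-partialFractions : ∀ x p q → p ≢ 0ℚ → q ≢ 0ℚ → x * p ⁻¹ * q ⁻¹ * (q - p) ≡ x * p ⁻¹ - x * q ⁻¹
⁻¹-partialFractions x p q p≢0 q≢0 = begin
    x * p ⁻¹ * q ⁻¹ * (q - p)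
  ≡⟨ solve 5 (λ x p′ q′ p q → x :* p′ :* q′ :* (q :- p) := x :* p′ :* (q :* q′) :- x :* q′ :* (p :* p′))
       refl x (p ⁻¹) (q ⁻¹) p q ⟩
    x * p ⁻¹ * (q * q ⁻¹) - x * q ⁻¹ * (p * p ⁻¹)
  ≡⟨ cong₂ (λ y z → x * p ⁻¹ * y - x * q ⁻¹ * z) (⁻¹-inverseʳ q q≢0) (⁻¹-inverseʳ p p≢0) ⟩
    x * p ⁻¹ * 1ℚ - x * q ⁻¹ * 1ℚ
  ≡⟨ cong₂ _-_ (QP.*-identityʳ (x * p ⁻¹)) (QP.*-identityʳ (x * q ⁻¹)) ⟩
    x * p ⁻¹ - x * q ⁻¹ ∎

divDiff-partialFractions : ∀ a b M (f : ℕ → ℚ) → All (a ≢_) M → All (b ≢_) M →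
  divDiff M (λ t → f t * (ι t - ι a) ⁻¹ * (ι t - ι b) ⁻¹) * (ι a - ι b)
    ≡ divDiff M (λ t → f t * (ι t - ι a) ⁻¹) - divDiff M (λ t → f t * (ι t - ι b) ⁻¹)
divDiff-partialFractions a b M f a∉M b∉M = begin
    divDiff M (λ t → f t * (ι t - ι a) ⁻¹ * (ι t - ι b) ⁻¹) * (ι a - ι b)
  ≡⟨ sym (divDiff-*ʳ M _ (ι a - ι b)) ⟩
    divDiff M (λ t → f t * (ι t - ι a) ⁻¹ * (ι t - ι b) ⁻¹ * (ι a - ι b))
  ≡⟨ divDiff-cong M (λ t t∈M → begin
       f t * (ι t - ι a) ⁻¹ * (ι t - ι b) ⁻¹ * (ι a - ι b)
     ≡⟨ cong (f t * (ι t - ι a) ⁻¹ * (ι t - ι b) ⁻¹ *_)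
          (solve 3 (λ a b t → a :- b := (t :- b) :- (t :- a)) refl (ι a) (ι b) (ι t)) ⟩
       f t * (ι t - ι a) ⁻¹ * (ι t - ι b) ⁻¹ * ((ι t - ι b) - (ι t - ι a))
     ≡⟨ ⁻¹-partialFractions (f t) (ι t - ι a) (ι t - ι b)
          (ι-≢⇒-≢0 (≢-sym (All.lookup a∉M t∈M))) (ι-≢⇒-≢0 (≢-sym (All.lookup b∉M t∈M))) ⟩
       f t * (ι t - ι a) ⁻¹ - f t * (ι t - ι b) ⁻¹ ∎) ⟩
    divDiff M (λ t → f t * (ι t - ι a) ⁻¹ - f t * (ι t - ι b) ⁻¹)
  ≡⟨ divDiff-- M _ _ ⟩
    divDiff M (λ t → f t * (ι t - ι a) ⁻¹) - divDiff M (λ t → f t * (ι t - ι b) ⁻¹) ∎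

⁻¹-*-cancelˡ : ∀ d p → d ≢ 0ℚ → (d * p) ⁻¹ * d ≡ p ⁻¹
⁻¹-*-cancelˡ d p d≢0 = begin
  (d * p) ⁻¹ * d        ≡⟨ cong (_* d) (⁻¹-distrib-* d p) ⟩
  d ⁻¹ * p ⁻¹ * d       ≡⟨ solve 3 (λ d′ p′ d → d′ :* p′ :* d := p′ :* (d :* d′)) refl (d ⁻¹) (p ⁻¹) d ⟩
  p ⁻¹ * (d * d ⁻¹)     ≡⟨ cong (p ⁻¹ *_) (⁻¹-inverseʳ d d≢0) ⟩
  p ⁻¹ * 1ℚ             ≡⟨ QP.*-identityʳ _ ⟩
  p ⁻¹                  ∎

divDiff-recurrence : ∀ a b M (f : ℕ → ℚ) → Unique (a ∷ b ∷ M) →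
  divDiff (a ∷ b ∷ M) f * (ι a - ι b) ≡ divDiff (a ∷ M) f - divDiff (b ∷ M) f
divDiff-recurrence a b M f ((a≢b All.∷ a∉M) ∷ (b∉M ∷ _)) = begin
    (f a * (d * πa) ⁻¹ + (f b * (ι b - ι a) ⁻¹ * πb ⁻¹ + divDiff M fab)) * d
  ≡⟨ solve 4 (λ x y z d → (x :+ (y :+ z)) :* d := x :* d :+ (y :* d :+ z :* d)) refl
       (f a * (d * πa) ⁻¹) (f b * (ι b - ι a) ⁻¹ * πb ⁻¹) (divDiff M fab) d ⟩
    f a * (d * πa) ⁻¹ * d + (f b * (ι b - ι a) ⁻¹ * πb ⁻¹ * d + divDiff M fab * d)
  ≡⟨ cong₂ _+_ termA (cong₂ _+_ termB (divDiff-partialFractions a b M f a∉M b∉M)) ⟩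
    f a * πa ⁻¹ + (- (f b * πb ⁻¹) + (divDiff M fa - divDiff M fb))
  ≡⟨ solve 4 (λ x y u v → x :+ (:- y :+ (u :- v)) := (x :+ u) :- (y :+ v)) refl
       (f a * πa ⁻¹) (f b * πb ⁻¹) (divDiff M fa) (divDiff M fb) ⟩
    (f a * πa ⁻¹ + divDiff M fa) - (f b * πb ⁻¹ + divDiff M fb) ∎
  where
  d  = ι a - ι b
  πa = ∏[ u ← M ] (ι a - ι u)
  πb = ∏[ u ← M ] (ι b - ι u)
  fa fb fab : ℕ → ℚ
  fa t  = f t * (ι t - ι a) ⁻¹
  fb t  = f t * (ι t - ι b) ⁻¹
  fab t = f t * (ι t - ι a) ⁻¹ * (ι t - ι b) ⁻¹
  d≢0 : d ≢ 0ℚ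
  d≢0 = ι-≢⇒-≢0 a≢b
  termA : f a * (d * πa) ⁻¹ * d ≡ f a * πa ⁻¹
  termA = trans (QP.*-assoc (f a) _ d) (cong (f a *_) (⁻¹-*-cancelˡ d πa d≢0))
  termB : f b * (ι b - ι a) ⁻¹ * πb ⁻¹ * d ≡ - (f b * πb ⁻¹)
  termB = begin
      f b * (ι b - ι a) ⁻¹ * πb ⁻¹ * d
    ≡⟨ cong (λ z → f b * z ⁻¹ * πb ⁻¹ * d) (solve 2 (λ x y → y :- x := :- (x :- y)) refl (ι a) (ι b)) ⟩
      f b * (- d) ⁻¹ * πb ⁻¹ * d
    ≡⟨ cong (λ z → f b * z * πb ⁻¹ * d) (⁻¹-neg d) ⟩
      f b * (- d ⁻¹) * πb ⁻¹ * d
    ≡⟨ solve 4 (λ x d′ p′ d → x :* (:- d′) :* p′ :* d := :- (x :* p′ :* (d :* d′))) refl (f b) (d ⁻¹) (πb ⁻¹) d ⟩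
      - (f b * πb ⁻¹ * (d * d ⁻¹))
    ≡⟨ cong (λ z → - (f b * πb ⁻¹ * z)) (⁻¹-inverseʳ d d≢0) ⟩
      - (f b * πb ⁻¹ * 1ℚ)
    ≡⟨ cong -_ (QP.*-identityʳ _) ⟩
      - (f b * πb ⁻¹) ∎

divDiff-const : ∀ a M → Unique (a ∷ M) → divDiff (a ∷ M) (λ _ → 1ℚ) ≡ δ 0 (length M)
divDiff-const a []      _ = trans (QP.+-identityʳ _) (cong (1ℚ *_) ⁻¹-1)
divDiff-const a (b ∷ M) u@((a≢b All.∷ a∉M) ∷ (b∉M ∷ uM)) =
  *-cancelʳ-≡0 _ (ι a - ι b) (ι-≢⇒-≢0 a≢b) (begin
    divDiff (a ∷ b ∷ M) one * (ι a - ι b)    ≡⟨ divDiff-recurrence a b M one u ⟩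
    divDiff (a ∷ M) one - divDiff (b ∷ M) one ≡⟨ cong₂ _-_ (divDiff-const a M (a∉M ∷ uM))
                                                           (divDiff-const b M (b∉M ∷ uM)) ⟩
    δ 0 (length M) - δ 0 (length M)          ≡⟨ QP.+-inverseʳ (δ 0 (length M)) ⟩
    0ℚ                                       ∎)
  where
  one : ℕ → ℚ
  one _ = 1ℚ

divDiff-pow : ∀ L {k e} → Unique L → length L ≡ suc k → e ≤ k → divDiff L (λ t → ι t ^ e) ≡ δ e k
divDiff-pow (a ∷ L) {k}     {zero}  uL         len _         =
  trans (divDiff-const a L uL) (cong (δ 0) (NP.suc-injective len))
divDiff-pow (a ∷ L) {suc k} {suc e} (a∉L ∷ uL) len (s≤s e≤k) = begin
    divDiff (a ∷ L) (λ t → ι t * ι t ^ e)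
  ≡⟨ divDiff-cong (a ∷ L) (λ t _ →
       solve 3 (λ x a p → x :* p := p :* (x :- a) :+ a :* p) refl (ι t) (ι a) (ι t ^ e)) ⟩
    divDiff (a ∷ L) (λ t → ι t ^ e * (ι t - ι a) + ι a * ι t ^ e)
  ≡⟨ divDiff-+ (a ∷ L) (λ t → ι t ^ e * (ι t - ι a)) (λ t → ι a * ι t ^ e) ⟩
    divDiff (a ∷ L) (λ t → ι t ^ e * (ι t - ι a)) + divDiff (a ∷ L) (λ t → ι a * ι t ^ e)
  ≡⟨ cong₂ _+_ (divDiff-shift a L (λ t → ι t ^ e) a∉L) (divDiff-*ˡ (a ∷ L) (ι a) _) ⟩
    divDiff L (λ t → ι t ^ e) + ι a * divDiff (a ∷ L) (λ t → ι t ^ e)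
  ≡⟨ cong₂ (λ x y → x + ι a * y) (divDiff-pow L uL (NP.suc-injective len) e≤k)
       (divDiff-pow (a ∷ L) (a∉L ∷ uL) len (NP.m≤n⇒m≤1+n e≤k)) ⟩
    δ e k + ι a * δ e (suc k)
  ≡⟨ cong (λ z → δ e k + ι a * z) (δ-< (s≤s e≤k)) ⟩
    δ e k + ι a * 0ℚ
  ≡⟨ trans (cong (δ e k +_) (QP.*-zeroʳ (ι a))) (QP.+-identityʳ _) ⟩
    δ e k ∎

-- The Combinatorial Nullstellensatz

∏ᶠ : ∀ {n} → (Fin n → ℚ) → ℚ
∏ᶠ = foldr _*_ 1ℚ

∏ᶠ-cong : ∀ {n} {g h : Fin n → ℚ} → (∀ u → g u ≡ h u) → ∏ᶠ g ≡ ∏ᶠ h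
∏ᶠ-cong {zero}  g≗h = refl
∏ᶠ-cong {suc n} g≗h = cong₂ _*_ (g≗h F.zero) (∏ᶠ-cong (g≗h ∘ F.suc))

∏ᶠ-1 : ∀ {n} → ∏ᶠ {n} (λ _ → 1ℚ) ≡ 1ℚ
∏ᶠ-1 {zero}  = refl
∏ᶠ-1 {suc n} = cong (1ℚ *_) (∏ᶠ-1 {n})

∏ᶠ-zero : ∀ {n} (g : Fin n → ℚ) u → g u ≡ 0ℚ → ∏ᶠ g ≡ 0ℚ
∏ᶠ-zero {suc n} g F.zero    g0≡0 = trans (cong (_* ∏ᶠ (g ∘ F.suc)) g0≡0) (QP.*-zeroˡ (∏ᶠ (g ∘ F.suc)))
∏ᶠ-zero {suc n} g (F.suc u) gu≡0 = trans (cong (g F.zero *_) (∏ᶠ-zero (g ∘ F.suc) u gu≡0)) (QP.*-zeroʳ (g F.zero))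

divDiffⁿ : ∀ {n} → (Fin n → List ℕ) → ((Fin n → ℕ) → ℚ) → ℚ
divDiffⁿ {zero}  L G = G []ᵛ
divDiffⁿ {suc n} L G = divDiff (L F.zero) (λ t → divDiffⁿ (L ∘ F.suc) (λ s → G (t ∷ᵛ s)))

divDiffⁿ-cong : ∀ {n} (L : Fin n → List ℕ) {G H : (Fin n → ℕ) → ℚ} →
                (∀ s → G s ≡ H s) → divDiffⁿ L G ≡ divDiffⁿ L H
divDiffⁿ-cong {zero}  L G≗H = G≗H []ᵛ
divDiffⁿ-cong {suc n} L G≗H = divDiff-cong (L F.zero) (λ t _ → divDiffⁿ-cong (L ∘ F.suc) (λ s → G≗H (t ∷ᵛ s)))

divDiffⁿ-+ : ∀ {n} (L : Fin n → List ℕ) (G H : (Fin n → ℕ) → ℚ) →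
             divDiffⁿ L (λ s → G s + H s) ≡ divDiffⁿ L G + divDiffⁿ L H
divDiffⁿ-+ {zero}  L G H = refl
divDiffⁿ-+ {suc n} L G H =
  trans (divDiff-cong (L F.zero) (λ t _ → divDiffⁿ-+ (L ∘ F.suc) _ _)) (divDiff-+ (L F.zero) _ _)

divDiffⁿ-*ˡ : ∀ {n} (L : Fin n → List ℕ) (c : ℚ) (G : (Fin n → ℕ) → ℚ) →
              divDiffⁿ L (λ s → c * G s) ≡ c * divDiffⁿ L G
divDiffⁿ-*ˡ {zero}  L c G = refl
divDiffⁿ-*ˡ {suc n} L c G =
  trans (divDiff-cong (L F.zero) (λ t _ → divDiffⁿ-*ˡ (L ∘ F.suc) c _)) (divDiff-*ˡ (L F.zero) c _)

divDiffⁿ-zero : ∀ {n} (L : Fin n → List ℕ) → divDiffⁿ L (λ _ → 0ℚ) ≡ 0ℚ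
divDiffⁿ-zero {zero}  L = refl
divDiffⁿ-zero {suc n} L =
  trans (divDiff-cong (L F.zero) (λ t _ → divDiffⁿ-zero (L ∘ F.suc))) (divDiff-zero (L F.zero) (λ t _ → refl))

divDiffⁿ-∑ : ∀ {n} (L : Fin n → List ℕ) {A : Set} (xs : List A) (G : A → (Fin n → ℕ) → ℚ) →
             divDiffⁿ L (λ s → ∑[ x ← xs ] G x s) ≡ ∑[ x ← xs ] divDiffⁿ L (G x)
divDiffⁿ-∑ L []       G = divDiffⁿ-zero L
divDiffⁿ-∑ L (x ∷ xs) G = trans (divDiffⁿ-+ L (G x) _) (cong (divDiffⁿ L (G x) +_) (divDiffⁿ-∑ L xs G))

divDiffⁿ-∏ᶠ : ∀ {n} (L : Fin n → List ℕ) (g : Fin n → ℕ → ℚ) →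
              divDiffⁿ L (λ s → ∏ᶠ (λ u → g u (s u))) ≡ ∏ᶠ (λ u → divDiff (L u) (g u))
divDiffⁿ-∏ᶠ {zero}  L g = refl
divDiffⁿ-∏ᶠ {suc n} L g = begin
    divDiff (L F.zero) (λ t → divDiffⁿ (L ∘ F.suc) (λ s → g F.zero t * ∏ᶠ (λ u → g (F.suc u) (s u))))
  ≡⟨ divDiff-cong (L F.zero) (λ t _ → trans (divDiffⁿ-*ˡ (L ∘ F.suc) (g F.zero t) _)
       (cong (g F.zero t *_) (divDiffⁿ-∏ᶠ (L ∘ F.suc) (g ∘ F.suc)))) ⟩
    divDiff (L F.zero) (λ t → g F.zero t * ∏ᶠ (λ u → divDiff (L (F.suc u)) (g (F.suc u))))
  ≡⟨ divDiff-*ʳ (L F.zero) (g F.zero) _ ⟩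
    divDiff (L F.zero) (g F.zero) * ∏ᶠ (λ u → divDiff (L (F.suc u)) (g (F.suc u))) ∎

divDiffⁿ≢0⇒witness : ∀ {n} (L : Fin n → List ℕ) (G : (Fin n → ℕ) → ℚ) → divDiffⁿ L G ≢ 0ℚ →
                     Σ (Fin n → ℕ) (λ s → (∀ u → s u ∈ L u) × G s ≢ 0ℚ)
divDiffⁿ≢0⇒witness {zero}  L G D≢0 = []ᵛ , (λ ()) , D≢0
divDiffⁿ≢0⇒witness {suc n} L G D≢0 with divDiff≢0⇒witness (L F.zero) _ D≢0
... | t , t∈L₀ , D′≢0 with divDiffⁿ≢0⇒witness (L ∘ F.suc) (λ s → G (t ∷ᵛ s)) D′≢0
...   | s , s∈L , Gts≢0 = t ∷ᵛ s , t∷s∈L , Gts≢0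
  where
  t∷s∈L : ∀ u → (t ∷ᵛ s) u ∈ L u
  t∷s∈L F.zero    = t∈L₀
  t∷s∈L (F.suc u) = s∈L u

totalDegree : ∀ {n} → (Fin n → ℕ) → ℕ
totalDegree = foldr N._+_ 0

totalDegree-cong : ∀ {n} {c d : Fin n → ℕ} → (∀ u → c u ≡ d u) → totalDegree c ≡ totalDegree d
totalDegree-cong {zero}  c≗d = refl
totalDegree-cong {suc n} c≗d = cong₂ N._+_ (c≗d F.zero) (totalDegree-cong (c≗d ∘ F.suc))

totalDegree-raise : ∀ {n} (c : Fin n → ℕ) x → totalDegree (updateAt c x suc) ≡ suc (totalDegree c)
totalDegree-raise {suc n} c F.zero    = refl
totalDegree-raise {suc n} c (F.suc x) =
  trans (cong (c F.zero N.+_) (totalDegree-raise (c ∘ F.suc) x)) (NP.+-suc (c F.zero) _)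

totalDegree-≤⇒≗⊎< : ∀ {n} (c d : Fin n → ℕ) → totalDegree c ≤ totalDegree d →
                     (∀ u → c u ≡ d u) ⊎ Σ (Fin n) (λ u → c u < d u)
totalDegree-≤⇒≗⊎< {zero}  c d _ = inj₁ (λ ())
totalDegree-≤⇒≗⊎< {suc n} c d c≤d with c F.zero NP.<? d F.zero
... | yes c₀<d₀ = inj₂ (F.zero , c₀<d₀)
... | no c₀≮d₀ with totalDegree-≤⇒≗⊎< (c ∘ F.suc) (d ∘ F.suc)
                      (NP.+-cancelˡ-≤ (d F.zero) _ _ (NP.≤-trans (NP.+-monoˡ-≤ _ (NP.≮⇒≥ c₀≮d₀)) c≤d))
...   | inj₂ (u , cu<du) = inj₂ (F.suc u , cu<du)
...   | inj₁ c′≗d′ = inj₁ c≗d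
  where
  c₀≤d₀ : c F.zero ≤ d F.zero
  c₀≤d₀ = NP.+-cancelʳ-≤ _ _ _
    (subst (λ z → c F.zero N.+ z ≤ d F.zero N.+ totalDegree (d ∘ F.suc)) (totalDegree-cong c′≗d′) c≤d)
  c≗d : ∀ u → c u ≡ d u
  c≗d F.zero    = NP.≤-antisym c₀≤d₀ (NP.≮⇒≥ c₀≮d₀)
  c≗d (F.suc u) = c′≗d′ u

monomial : ∀ {n} → (Fin n → ℕ) → (Fin n → ℕ) → ℚ
monomial c s = ∏ᶠ (λ u → ι (s u) ^ c u)

monomial-raise : ∀ {n} (c : Fin n → ℕ) x s → monomial (updateAt c x suc) s ≡ ι (s x) * monomial c s
monomial-raise {suc n} c F.zero    s = QP.*-assoc (ι (s F.zero)) _ _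
monomial-raise {suc n} c (F.suc x) s = begin
    p * monomial (updateAt (c ∘ F.suc) x suc) (s ∘ F.suc)
  ≡⟨ cong (p *_) (monomial-raise (c ∘ F.suc) x (s ∘ F.suc)) ⟩
    p * (ι (s (F.suc x)) * monomial (c ∘ F.suc) (s ∘ F.suc))
  ≡⟨ solve 3 (λ a b c → a :* (b :* c) := b :* (a :* c)) refl p (ι (s (F.suc x))) _ ⟩
    ι (s (F.suc x)) * (p * monomial (c ∘ F.suc) (s ∘ F.suc)) ∎
  where p = ι (s F.zero) ^ c F.zero

module _ {A : Set} where

  allB-cong : (xs : List A) {p q : A → Bool} → (∀ x → p x ≡ q x) → allB p xs ≡ allB q xs
  allB-cong []       p≗q = refl
  allB-cong (x ∷ xs) p≗q = cong₂ _∧_ (p≗q x) (allB-cong xs p≗q)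

  allB-true : (p : A → Bool) {xs : List A} → All (λ x → p x ≡ true) xs → allB p xs ≡ true
  allB-true p All.[]              = refl
  allB-true p (px≡true All.∷ ps) rewrite px≡true = allB-true p ps

  allB-++ : (p : A → Bool) (xs ys : List A) → allB p (xs ++ ys) ≡ allB p xs ∧ allB p ys
  allB-++ p []       ys = refl
  allB-++ p (x ∷ xs) ys rewrite allB-++ p xs ys = sym (BP.∧-assoc (p x) (allB p xs) (allB p ys))

  allB-map : {B : Set} (p : B → Bool) (f : A → B) (xs : List A) → allB p (map f xs) ≡ allB (p ∘ f) xs
  allB-map p f []       = refl
  allB-map p f (x ∷ xs) = cong (p (f x) ∧_) (allB-map p f xs)

  allB-false : (xs : List A) (p : A → Bool) {x : A} → x ∈ xs → p x ≡ false → allB p xs ≡ false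
  allB-false (y ∷ xs) p (here refl) px≡false rewrite px≡false = refl
  allB-false (y ∷ xs) p (there x∈xs) px≡false with p y
  ... | true  = allB-false xs p x∈xs px≡false
  ... | false = refl

isZero : ℤ → Bool
isZero (Z.+ zero) = true
isZero _          = false

isZero-≢0 : ∀ {z} → z ≢ Z.0ℤ → isZero z ≡ false
isZero-≢0 {Z.+ zero}   z≢0 = ⊥-elim (z≢0 refl)
isZero-≢0 {Z.+ suc _}  _   = refl
isZero-≢0 {Z.-[1+ _ ]} _   = refl

updateAt-≗ : ∀ {n} {A : Set} {γ γ′ : Fin n → A} x (f : A → A) → (∀ u → γ u ≡ γ′ u) →
             ∀ u → updateAt γ x f u ≡ updateAt γ′ x f u
updateAt-≗ {γ = γ} {γ′} x f γ≗γ′ u with u F.≟ x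
... | yes refl = trans (updateAt-updates u γ) (trans (cong f (γ≗γ′ u)) (sym (updateAt-updates u γ′)))
... | no u≢x   = trans (updateAt-minimal u x γ u≢x) (trans (γ≗γ′ u) (sym (updateAt-minimal u x γ′ u≢x)))

module _ {n : ℕ} where

  allZero : (Fin n → ℤ) → Bool
  allZero γ = allB (λ u → isZero (γ u)) (allFin n)

  linForm : (Fin n → ℚ) → (Fin n → ℕ) → ℚ
  linForm k s = ∑[ x ← allFin n ] (k x * ι (s x))

  lower : (Fin n → ℤ) → Fin n → Fin n → ℤ
  lower γ x = updateAt γ x (Z._- Z.1ℤ)

  -- The coefficient of ∏_u X_u ^ γ u in ∏_{k ∈ ks} ∑_x k x X_x (zero as soon as some γ u < 0).
  coeff : List (Fin n → ℚ) → (Fin n → ℤ) → ℚ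
  coeff []       γ = if allZero γ then 1ℚ else 0ℚ
  coeff (k ∷ ks) γ = ∑[ x ← allFin n ] (k x * coeff ks (lower γ x))

  coeff-cong : ∀ ks {γ γ′ : Fin n → ℤ} → (∀ u → γ u ≡ γ′ u) → coeff ks γ ≡ coeff ks γ′
  coeff-cong []       γ≗γ′ = cong (if_then 1ℚ else 0ℚ) (allB-cong (allFin n) (cong isZero ∘ γ≗γ′))
  coeff-cong (k ∷ ks) γ≗γ′ =
    ∑-cong (allFin n) (λ x → cong (k x *_) (coeff-cong ks (updateAt-≗ x (Z._- Z.1ℤ) γ≗γ′)))

totalDegree-0 : ∀ {n} → totalDegree {n} (λ _ → 0) ≡ 0
totalDegree-0 {zero}  = refl
totalDegree-0 {suc n} = totalDegree-0 {n}

-- With |L u| = d u + 1 and deg P = ∑ d, the iterated divided difference of P over the grid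
-- ∏_u L u is the coefficient of ∏_u X_u ^ d u, because a divided difference on k + 1 nodes
-- kills t ^ e for e < k and sends t ^ k to 1.
module Nullstellensatz {n : ℕ} (L : Fin n → List ℕ) (d : Fin n → ℕ)
  (L-unique : ∀ u → Unique (L u)) (L-length : ∀ u → length (L u) ≡ suc (d u)) where

  gap : (Fin n → ℕ) → Fin n → ℤ
  gap c u = Z.+ d u Z.- Z.+ c u

  lower-gap : ∀ c x u → lower (gap c) x u ≡ gap (updateAt c x suc) u
  lower-gap c x u with u F.≟ x
  ... | no u≢x   = trans (updateAt-minimal u x (gap c) u≢x)
                         (cong (λ e → Z.+ d u Z.- Z.+ e) (sym (updateAt-minimal u x c u≢x)))
  ... | yes refl = begin
      lower (gap c) u u
    ≡⟨ updateAt-updates u (gap c) ⟩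
      (Z.+ d u Z.- Z.+ c u) Z.- Z.1ℤ
    ≡⟨ ZS.solve 2 (λ a b → (a ZS.:- b) ZS.:- ZS.con Z.1ℤ ZS.:= a ZS.:- (ZS.con Z.1ℤ ZS.:+ b)) refl (Z.+ d u) (Z.+ c u) ⟩
      Z.+ d u Z.- (Z.1ℤ Z.+ Z.+ c u)
    ≡⟨ cong (λ e → Z.+ d u Z.- Z.+ e) (sym (updateAt-updates u c)) ⟩
      gap (updateAt c u suc) u ∎

  divDiffⁿ-monomial : ∀ c → totalDegree c ≡ totalDegree d → divDiffⁿ L (monomial c) ≡ coeff [] (gap c)
  divDiffⁿ-monomial c deg≡ with totalDegree-≤⇒≗⊎< c d (NP.≤-reflexive deg≡)
  ... | inj₁ c≗d = begin
      divDiffⁿ L (monomial c)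
    ≡⟨ divDiffⁿ-∏ᶠ L (λ u t → ι t ^ c u) ⟩
      ∏ᶠ (λ u → divDiff (L u) (λ t → ι t ^ c u))
    ≡⟨ ∏ᶠ-cong (λ u → begin
         divDiff (L u) (λ t → ι t ^ c u) ≡⟨ divDiff-pow (L u) (L-unique u) (L-length u) (NP.≤-reflexive (c≗d u)) ⟩
         δ (c u) (d u)                   ≡⟨ cong (λ e → δ e (d u)) (c≗d u) ⟩
         δ (d u) (d u)                   ≡⟨ δ-refl (d u) ⟩
         1ℚ                              ∎) ⟩
      ∏ᶠ {n} (λ _ → 1ℚ)
    ≡⟨ ∏ᶠ-1 {n} ⟩
      1ℚ
    ≡⟨ cong (if_then 1ℚ else 0ℚ) (sym (allB-true _ (All.universal gap≡0 (allFin n)))) ⟩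
      coeff [] (gap c) ∎
    where
    gap≡0 : ∀ u → isZero (gap c u) ≡ true
    gap≡0 u rewrite c≗d u = cong isZero (ZP.+-inverseʳ (Z.+ d u))
  ... | inj₂ (u , cu<du) = begin
      divDiffⁿ L (monomial c)
    ≡⟨ divDiffⁿ-∏ᶠ L (λ u t → ι t ^ c u) ⟩
      ∏ᶠ (λ u → divDiff (L u) (λ t → ι t ^ c u))
    ≡⟨ ∏ᶠ-zero _ u (trans (divDiff-pow (L u) (L-unique u) (L-length u) (NP.<⇒≤ cu<du)) (δ-< cu<du)) ⟩
      0ℚ
    ≡⟨ cong (if_then 1ℚ else 0ℚ) (sym (allB-false (allFin n) _ (∈-allFin u) (isZero-≢0 gap≢0))) ⟩
      coeff [] (gap c) ∎
    where
    gap≢0 : gap c u ≢ Z.0ℤ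
    gap≢0 gap≡0 = NP.<⇒≢ cu<du (sym (ZP.+-injective (ZP.i-j≡0⇒i≡j _ _ gap≡0)))

  divDiffⁿ-linearProduct : ∀ ks c → length ks N.+ totalDegree c ≡ totalDegree d →
    divDiffⁿ L (λ s → ∏[ k ← ks ] linForm k s * monomial c s) ≡ coeff ks (gap c)
  divDiffⁿ-linearProduct [] c deg≡ =
    trans (divDiffⁿ-cong L (λ s → QP.*-identityˡ _)) (divDiffⁿ-monomial c deg≡)
  divDiffⁿ-linearProduct (k ∷ ks) c deg≡ = begin
      divDiffⁿ L (λ s → (linForm k s * P s) * monomial c s)
    ≡⟨ divDiffⁿ-cong L expand ⟩
      divDiffⁿ L (λ s → ∑[ x ← allFin n ] (k x * (P s * monomial (updateAt c x suc) s)))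
    ≡⟨ divDiffⁿ-∑ L (allFin n) (λ x s → k x * (P s * monomial (updateAt c x suc) s)) ⟩
      ∑[ x ← allFin n ] divDiffⁿ L (λ s → k x * (P s * monomial (updateAt c x suc) s))
    ≡⟨ ∑-cong (allFin n) (λ x → trans (divDiffⁿ-*ˡ L (k x) _) (cong (k x *_) (begin
         divDiffⁿ L (λ s → P s * monomial (updateAt c x suc) s)
       ≡⟨ divDiffⁿ-linearProduct ks (updateAt c x suc) (deg≡′ x) ⟩
         coeff ks (gap (updateAt c x suc))
       ≡⟨ coeff-cong ks (λ u → sym (lower-gap c x u)) ⟩
         coeff ks (lower (gap c) x) ∎))) ⟩
      coeff (k ∷ ks) (gap c) ∎
    where
    P : (Fin n → ℕ) → ℚ
    P s = ∏[ k ← ks ] linForm k s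
    deg≡′ : ∀ x → length ks N.+ totalDegree (updateAt c x suc) ≡ totalDegree d
    deg≡′ x = trans (cong (length ks N.+_) (totalDegree-raise c x)) (trans (NP.+-suc (length ks) _) deg≡)
    expand : ∀ s → (linForm k s * P s) * monomial c s
                 ≡ ∑[ x ← allFin n ] (k x * (P s * monomial (updateAt c x suc) s))
    expand s = begin
        (linForm k s * P s) * monomial c s
      ≡⟨ QP.*-assoc (linForm k s) (P s) (monomial c s) ⟩
        linForm k s * (P s * monomial c s)
      ≡⟨ sym (∑-*ʳ (allFin n) (λ x → k x * ι (s x)) _) ⟩
        ∑[ x ← allFin n ] (k x * ι (s x) * (P s * monomial c s))
      ≡⟨ ∑-cong (allFin n) (λ x → trans
           (solve 4 (λ k i p m → k :* i :* (p :* m) := k :* (p :* (i :* m))) refl (k x) (ι (s x)) (P s) (monomial c s))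
           (cong (λ z → k x * (P s * z)) (sym (monomial-raise c x s)))) ⟩
        ∑[ x ← allFin n ] (k x * (P s * monomial (updateAt c x suc) s)) ∎

  nullstellensatz : ∀ ks → length ks ≡ totalDegree d → coeff ks (Z.+_ ∘ d) ≢ 0ℚ →
    Σ (Fin n → ℕ) (λ s → (∀ u → s u ∈ L u) × ∏[ k ← ks ] linForm k s ≢ 0ℚ)
  nullstellensatz ks len≡ coeff≢0 = divDiffⁿ≢0⇒witness L P (λ D≡0 → coeff≢0 (trans (sym D≡coeff) D≡0))
    where
    P : (Fin n → ℕ) → ℚ
    P s = ∏[ k ← ks ] linForm k s
    D≡coeff : divDiffⁿ L P ≡ coeff ks (Z.+_ ∘ d)
    D≡coeff = begin
        divDiffⁿ L P
      ≡⟨ divDiffⁿ-cong L (λ s → trans (sym (QP.*-identityʳ (P s))) (cong (P s *_) (sym (∏ᶠ-1 {n})))) ⟩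
        divDiffⁿ L (λ s → P s * monomial (λ _ → 0) s)
      ≡⟨ divDiffⁿ-linearProduct ks (λ _ → 0)
           (trans (cong (length ks N.+_) (totalDegree-0 {n})) (trans (NP.+-identityʳ _) len≡)) ⟩
        coeff ks (gap (λ _ → 0))
      ≡⟨ coeff-cong ks (λ u → ZP.+-identityʳ (Z.+ d u)) ⟩
        coeff ks (Z.+_ ∘ d) ∎

-- Signed counts of balanced arc sets

χ : Bool → ℤ
χ true  = Z.1ℤ
χ false = Z.0ℤ

module _ {n : ℕ} where

  infixl 6 _+∂_

  _+∂_ : (WV n → ℤ) → Arc n → WV n → ℤ
  (β +∂ (p , q)) u = β u Z.+ (χ (eqWV p u) Z.- χ (eqWV q u))

  -- eulerSum H β = ∑_{S ⊆ H} (-1)^|S| [β + outD S - inD S = 0]; EE H - EO H is its value at β = 0.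
  eulerSum : List (Arc n) → (WV n → ℤ) → ℚ
  eulerSum []      β = if allB (λ u → isZero (β u)) (allWV n) then 1ℚ else 0ℚ
  eulerSum (a ∷ H) β = eulerSum H β - eulerSum H (β +∂ a)

  eulerSum-cong : ∀ H {β β′ : WV n → ℤ} → (∀ u → β u ≡ β′ u) → eulerSum H β ≡ eulerSum H β′
  eulerSum-cong []      β≗β′ = cong (if_then 1ℚ else 0ℚ) (allB-cong (allWV n) (cong isZero ∘ β≗β′))
  eulerSum-cong (a ∷ H) β≗β′ = cong₂ _-_ (eulerSum-cong H β≗β′) (eulerSum-cong H (+∂-cong a β≗β′))
    where
    +∂-cong : ∀ a {β β′ : WV n → ℤ} → (∀ u → β u ≡ β′ u) → ∀ u → (β +∂ a) u ≡ (β′ +∂ a) u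
    +∂-cong (p , q) β≗β′ u = cong (Z._+ (χ (eqWV p u) Z.- χ (eqWV q u))) (β≗β′ u)

sign : ℕ → ℚ
sign k = if isEven k then 1ℚ else - 1ℚ

isEven-suc : ∀ k → isEven (suc k) ≡ not (isEven k)
isEven-suc zero    = refl
isEven-suc (suc k) = trans (sym (BP.not-involutive (isEven k))) (cong not (sym (isEven-suc k)))

sign-suc : ∀ k → sign (suc k) ≡ - sign k
sign-suc k rewrite isEven-suc k with isEven k
... | true  = refl
... | false = refl

count-evenOdd : {A : Set} (P : A → Bool) (m : A → ℕ) (xs : List A) →
  ι (count (λ x → P x ∧ isEven (m x)) xs) - ι (count (λ x → P x ∧ not (isEven (m x))) xs)
    ≡ ∑[ x ← xs ] (if P x then sign (m x) else 0ℚ)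
count-evenOdd P m []       = refl
count-evenOdd P m (x ∷ xs) with P x | isEven (m x)
... | false | _     = trans (count-evenOdd P m xs) (sym (QP.+-identityˡ _))
... | true  | true  = trans
  (solve 2 (λ a b → (con 1ℚ :+ a) :- b := con 1ℚ :+ (a :- b)) refl (ι (count _ xs)) (ι (count _ xs)))
  (cong (1ℚ +_) (count-evenOdd P m xs))
... | true  | false = trans
  (solve 2 (λ a b → a :- (con 1ℚ :+ b) := (:- con 1ℚ) :+ (a :- b)) refl (ι (count _ xs)) (ι (count _ xs)))
  (cong (- 1ℚ +_) (count-evenOdd P m xs))

count-∷ : {A : Set} (f : A → Bool) (x : A) (xs : List A) → Z.+ count f (x ∷ xs) ≡ χ (f x) Z.+ Z.+ count f xs
count-∷ f x xs with f x
... | true  = ZP.pos-+ 1 (count f xs)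
... | false = sym (ZP.+-identityˡ _)

module _ {n : ℕ} where

  ∂ : List (Arc n) → WV n → ℤ
  ∂ S u = Z.+ outD S u Z.- Z.+ inD S u

  balanced : (WV n → ℤ) → List (Arc n) → Bool
  balanced β S = allB (λ u → isZero (β u Z.+ ∂ S u)) (allWV n)

  ∂-∷ : ∀ (β : WV n → ℤ) a S u → β u Z.+ ∂ (a ∷ S) u ≡ (β +∂ a) u Z.+ ∂ S u
  ∂-∷ β a@(p , q) S u = begin
      β u Z.+ (Z.+ outD (a ∷ S) u Z.- Z.+ inD (a ∷ S) u)
    ≡⟨ cong₂ (λ o i → β u Z.+ (o Z.- i))
         (count-∷ (λ a → eqWV (proj₁ a) u) a S) (count-∷ (λ a → eqWV (proj₂ a) u) a S) ⟩
      β u Z.+ ((χ (eqWV p u) Z.+ Z.+ outD S u) Z.- (χ (eqWV q u) Z.+ Z.+ inD S u))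
    ≡⟨ ZS.solve 5 (λ b x y o i → b ZS.:+ ((x ZS.:+ o) ZS.:- (y ZS.:+ i)) ZS.:= (b ZS.:+ (x ZS.:- y)) ZS.:+ (o ZS.:- i))
         refl (β u) (χ (eqWV p u)) (χ (eqWV q u)) (Z.+ outD S u) (Z.+ inD S u) ⟩
      (β +∂ a) u Z.+ ∂ S u ∎

  signedTerm : (WV n → ℤ) → List (Arc n) → ℚ
  signedTerm β S = if balanced β S then sign (length S) else 0ℚ

  signedTerm-∷ : ∀ β a S → signedTerm β (a ∷ S) ≡ - signedTerm (β +∂ a) S
  signedTerm-∷ β a S rewrite allB-cong (allWV n) (cong isZero ∘ ∂-∷ β a S) with balanced (β +∂ a) S
  ... | true  = sign-suc (length S)
  ... | false = refl

  ∑-sublists : ∀ H β → ∑ (sublists H) (signedTerm β) ≡ eulerSum H β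
  ∑-sublists []      β = trans (QP.+-identityʳ _)
    (cong (if_then 1ℚ else 0ℚ) (allB-cong (allWV n) (λ u → cong isZero (ZP.+-identityʳ (β u)))))
  ∑-sublists (a ∷ H) β = begin
      ∑ (sublists H ++ map (a ∷_) (sublists H)) (signedTerm β)
    ≡⟨ ∑-++ (sublists H) _ (signedTerm β) ⟩
      ∑ (sublists H) (signedTerm β) + ∑ (map (a ∷_) (sublists H)) (signedTerm β)
    ≡⟨ cong (∑ (sublists H) (signedTerm β) +_) (begin
         ∑ (map (a ∷_) (sublists H)) (signedTerm β)      ≡⟨ ∑-map (a ∷_) (sublists H) (signedTerm β) ⟩
         ∑[ S ← sublists H ] signedTerm β (a ∷ S)        ≡⟨ ∑-cong (sublists H) (signedTerm-∷ β a) ⟩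
         ∑[ S ← sublists H ] (- signedTerm (β +∂ a) S)   ≡⟨ ∑-neg (sublists H) (signedTerm (β +∂ a)) ⟩
         - ∑ (sublists H) (signedTerm (β +∂ a))          ∎) ⟩
      ∑ (sublists H) (signedTerm β) - ∑ (sublists H) (signedTerm (β +∂ a))
    ≡⟨ cong₂ _-_ (∑-sublists H β) (∑-sublists H (β +∂ a)) ⟩
      eulerSum H β - eulerSum H (β +∂ a) ∎

  isEulerian≡balanced : ∀ S → isEulerian S ≡ balanced (λ _ → Z.0ℤ) S
  isEulerian≡balanced S = allB-cong (allWV n) (λ u → ≟≡isZero-difference (outD S u) (inD S u))
    where
    ≟≡isZero-difference : ∀ o i → ⌊ o NP.≟ i ⌋ ≡ isZero (Z.0ℤ Z.+ (Z.+ o Z.- Z.+ i))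
    ≟≡isZero-difference o i with o NP.≟ i
    ... | yes refl = sym (cong isZero (trans (ZP.+-identityˡ _) (ZP.+-inverseʳ (Z.+ o))))
    ... | no o≢i   = sym (isZero-≢0 (λ e → o≢i (ZP.+-injective (ZP.i-j≡0⇒i≡j _ _ (trans (sym (ZP.+-identityˡ _)) e)))))

  EE-EO≡eulerSum : ∀ H → ι (EE H) - ι (EO H) ≡ eulerSum H (λ _ → Z.0ℤ)
  EE-EO≡eulerSum H = begin
      ι (EE H) - ι (EO H)
    ≡⟨ count-evenOdd isEulerian length (sublists H) ⟩
      ∑[ S ← sublists H ] (if isEulerian S then sign (length S) else 0ℚ)
    ≡⟨ ∑-cong (sublists H) (λ S → cong (if_then sign (length S) else 0ℚ) (isEulerian≡balanced S)) ⟩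
      ∑ (sublists H) (signedTerm (λ _ → Z.0ℤ))
    ≡⟨ ∑-sublists H (λ _ → Z.0ℤ) ⟩
      eulerSum H (λ _ → Z.0ℤ) ∎

module _ {n : ℕ} where

  eqWV-refl : (u : WV n) → eqWV u u ≡ true
  eqWV-refl (star x)     = ==-refl x
  eqWV-refl (sec a b c)  rewrite ==-refl a | ==-refl b | ==-refl c = refl
  eqWV-refl (ysec a b c) rewrite ==-refl a | ==-refl b | ==-refl c = refl

  private
    vertices : Fin n → Fin n → Fin n → List (WV n)
    vertices a b c = sec a b c ∷ ysec a b c ∷ []

    ∈-sectorVertices : ∀ {u} a b c → u ∈ vertices a b c →
      u ∈ concatMap (λ a → concatMap (λ b → concatMap (vertices a b) (allFin n)) (allFin n)) (allFin n)
    ∈-sectorVertices a b c u∈ =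
      ∈-concatMap⁺ _ (lose (∈-allFin a) (∈-concatMap⁺ _ (lose (∈-allFin b) (∈-concatMap⁺ _ (lose (∈-allFin c) u∈)))))

  ∈-allWV : (u : WV n) → u ∈ allWV n
  ∈-allWV (star x)     = ∈-++⁺ˡ (∈-map⁺ star (∈-allFin x))
  ∈-allWV (sec a b c)  = ∈-++⁺ʳ (map star (allFin n)) (∈-sectorVertices a b c (here refl))
  ∈-allWV (ysec a b c) = ∈-++⁺ʳ (map star (allFin n)) (∈-sectorVertices a b c (there (here refl)))

  Untouched : List (Arc n) → WV n → Set
  Untouched H u = All (λ a → eqWV (proj₁ a) u ≡ false × eqWV (proj₂ a) u ≡ false) H

  +∂-away : ∀ (β : WV n → ℤ) p q u → eqWV p u ≡ false → eqWV q u ≡ false → (β +∂ (p , q)) u ≡ β u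
  +∂-away β p q u p≢u q≢u rewrite p≢u | q≢u = ZP.+-identityʳ (β u)

  +∂-source : ∀ (β : WV n → ℤ) u q → eqWV q u ≡ false → (β +∂ (u , q)) u ≡ β u Z.+ Z.1ℤ
  +∂-source β u q q≢u rewrite eqWV-refl u | q≢u = refl

  +∂-target : ∀ (β : WV n → ℤ) p u → eqWV p u ≡ false → (β +∂ (p , u)) u ≡ β u Z.- Z.1ℤ
  +∂-target β p u p≢u rewrite eqWV-refl u | p≢u = refl

  +∂-+∂ : ∀ (β : WV n → ℤ) a z b u → (β +∂ (a , z) +∂ (z , b)) u ≡ (β +∂ (a , b)) u
  +∂-+∂ β a z b u = ZS.solve 4 (λ β a z b → (β ZS.:+ (a ZS.:- z)) ZS.:+ (z ZS.:- b) ZS.:= β ZS.:+ (a ZS.:- b))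
    refl (β u) (χ (eqWV a u)) (χ (eqWV z u)) (χ (eqWV b u))

  eulerSum-untouched : ∀ H β u → Untouched H u → β u ≢ Z.0ℤ → eulerSum H β ≡ 0ℚ
  eulerSum-untouched []      β u _ βu≢0 =
    cong (if_then 1ℚ else 0ℚ) (allB-false (allWV n) _ (∈-allWV u) (isZero-≢0 βu≢0))
  eulerSum-untouched ((p , q) ∷ H) β u ((p≢u , q≢u) All.∷ unt) βu≢0 = cong₂ _-_
    (eulerSum-untouched H β u unt βu≢0)
    (eulerSum-untouched H (β +∂ (p , q)) u unt (λ e → βu≢0 (trans (sym (+∂-away β p q u p≢u q≢u)) e)))

  eulerSum-untouched′ : ∀ H β u {c} → Untouched H u → β u ≡ c → c ≢ Z.0ℤ → eulerSum H β ≡ 0ℚ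
  eulerSum-untouched′ H β u unt βu≡c c≢0 = eulerSum-untouched H β u unt (λ βu≡0 → c≢0 (trans (sym βu≡c) βu≡0))

  -- Balanced arc sets use both or neither of the two arcs at the otherwise untouched vertex z.
  eulerSum-series : ∀ R β a z b → Untouched R z → β z ≡ Z.0ℤ → eqWV a z ≡ false → eqWV b z ≡ false →
    eulerSum ((a , z) ∷ (z , b) ∷ R) β ≡ eulerSum R β + eulerSum R (β +∂ (a , b))
  eulerSum-series R β a z b unt βz≡0 a≢z b≢z = begin
      (eulerSum R β - eulerSum R (β +∂ (z , b))) - (eulerSum R (β +∂ (a , z)) - eulerSum R (β +∂ (a , z) +∂ (z , b)))
    ≡⟨ cong₂ (λ x y → (eulerSum R β - x) - (y - eulerSum R (β +∂ (a , z) +∂ (z , b)))) leave enter ⟩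
      (eulerSum R β - 0ℚ) - (0ℚ - eulerSum R (β +∂ (a , z) +∂ (z , b)))
    ≡⟨ cong (λ x → (eulerSum R β - 0ℚ) - (0ℚ - x)) (eulerSum-cong R (+∂-+∂ β a z b)) ⟩
      (eulerSum R β - 0ℚ) - (0ℚ - eulerSum R (β +∂ (a , b)))
    ≡⟨ solve 2 (λ x y → (x :- con 0ℚ) :- (con 0ℚ :- y) := x :+ y) refl (eulerSum R β) _ ⟩
      eulerSum R β + eulerSum R (β +∂ (a , b)) ∎
    where
    leave : eulerSum R (β +∂ (z , b)) ≡ 0ℚ
    leave = eulerSum-untouched′ R _ z unt (trans (+∂-source β z b b≢z) (cong (Z._+ Z.1ℤ) βz≡0)) (λ ())
    enter : eulerSum R (β +∂ (a , z)) ≡ 0ℚ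
    enter = eulerSum-untouched′ R _ z unt (trans (+∂-target β a z a≢z) (cong (Z._- Z.1ℤ) βz≡0)) (λ ())

  eulerSum-series₃ : ∀ R β a z₁ z₂ b → Untouched R z₁ → Untouched R z₂ → β z₁ ≡ Z.0ℤ → β z₂ ≡ Z.0ℤ →
    eqWV a z₁ ≡ false → eqWV a z₂ ≡ false → eqWV z₁ z₂ ≡ false → eqWV b z₁ ≡ false → eqWV b z₂ ≡ false →
    eulerSum ((a , z₁) ∷ (z₁ , z₂) ∷ (z₂ , b) ∷ R) β ≡ eulerSum R β - eulerSum R (β +∂ (a , b))
  eulerSum-series₃ R β a z₁ z₂ b unt₁ unt₂ βz₁≡0 βz₂≡0 a≢z₁ a≢z₂ z₁≢z₂ b≢z₁ b≢z₂ = begin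
      eulerSum ((z₁ , z₂) ∷ (z₂ , b) ∷ R) β - eulerSum ((z₁ , z₂) ∷ (z₂ , b) ∷ R) β₁
    ≡⟨ cong₂ _-_ (eulerSum-series R β z₁ z₂ b unt₂ βz₂≡0 z₁≢z₂ b≢z₂)
                 (eulerSum-series R β₁ z₁ z₂ b unt₂ β₁z₂≡0 z₁≢z₂ b≢z₂) ⟩
      (eulerSum R β + eulerSum R (β +∂ (z₁ , b))) - (eulerSum R β₁ + eulerSum R (β₁ +∂ (z₁ , b)))
    ≡⟨ cong₂ (λ x y → (eulerSum R β + x) - (y + eulerSum R (β₁ +∂ (z₁ , b)))) leave enter ⟩
      (eulerSum R β + 0ℚ) - (0ℚ + eulerSum R (β₁ +∂ (z₁ , b)))
    ≡⟨ cong (λ x → (eulerSum R β + 0ℚ) - (0ℚ + x)) (eulerSum-cong R (+∂-+∂ β a z₁ b)) ⟩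
      (eulerSum R β + 0ℚ) - (0ℚ + eulerSum R (β +∂ (a , b)))
    ≡⟨ solve 2 (λ x y → (x :+ con 0ℚ) :- (con 0ℚ :+ y) := x :- y) refl (eulerSum R β) _ ⟩
      eulerSum R β - eulerSum R (β +∂ (a , b)) ∎
    where
    β₁ = β +∂ (a , z₁)
    β₁z₂≡0 : β₁ z₂ ≡ Z.0ℤ
    β₁z₂≡0 = trans (+∂-away β a z₁ z₂ a≢z₂ z₁≢z₂) βz₂≡0
    leave : eulerSum R (β +∂ (z₁ , b)) ≡ 0ℚ
    leave = eulerSum-untouched′ R _ z₁ unt₁ (trans (+∂-source β z₁ b b≢z₁) (cong (Z._+ Z.1ℤ) βz₁≡0)) (λ ())
    enter : eulerSum R β₁ ≡ 0ℚ
    enter = eulerSum-untouched′ R _ z₁ unt₁ (trans (+∂-target β a z₁ a≢z₁) (cong (Z._- Z.1ℤ) βz₁≡0)) (λ ())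

-- Contracting a sector

All-concatMap⁺ : {A B : Set} {P : B → Set} (f : A → List B) {xs : List A} →
                 (∀ {x} → x ∈ xs → All P (f x)) → All P (concatMap f xs)
All-concatMap⁺ f h = AllP.concat⁺ (AllP.map⁺ (All.tabulate h))

All-guard⁺ : {B : Set} {P : B → Set} (b : Bool) {xs : List B} → All P xs → All P (guard b xs)
All-guard⁺ true  ps = ps
All-guard⁺ false _  = All.[]

iverson : Bool → ℚ
iverson true  = 1ℚ
iverson false = 0ℚ

arcForm : ∀ {n} → (Fin n → Fin n → Bool) → Fin n → Fin n → Fin n → ℚ
arcForm A v w x = iverson (nbr A v x) - iverson (nbr A w x)

-- In the vw-sector, hub = v^{vw}, X x = x^{vw} and Y x = y^{vw}_x.  By definition
-- sectorArcs A v w is (v^* , hub) followed by the chunks, chunk x being the path from the hub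
-- to x^* (through X x if short x, i.e. x ∈ N(v) \ N(w); through Y x, X x if long x, i.e.
-- x ∈ N(w) \ N[v]).  κ agrees with arcForm A v w except at x = v.
module Sector {n : ℕ} (A : Fin n → Fin n → Bool) (A-irrefl : ∀ u → A u u ≡ false) (v w : Fin n) where

  hub : WV n
  hub = sec v w v

  X Y : Fin n → WV n
  X x = sec v w x
  Y x = ysec v w x

  short long : Fin n → Bool
  short x = nbr A v x ∧ not (nbr A w x)
  long  x = nbr A w x ∧ not (nbr A v x) ∧ not (x == v)

  chunk : Fin n → List (Arc n)
  chunk x = guard (short x) ((hub , X x) ∷ (X x , star x) ∷ [])
         ++ guard (long x) ((hub , Y x) ∷ (Y x , X x) ∷ (X x , star x) ∷ [])

  κ : Fin n → ℚ
  κ x = iverson (short x) - iverson (long x)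

  nbr-irrefl : ∀ u → nbr A u u ≡ false
  nbr-irrefl u rewrite A-irrefl u = refl

  short⇒≢ : ∀ x → short x ≡ true → x ≢ v
  short⇒≢ x s refl with nbr A x x | nbr-irrefl x
  short⇒≢ x () refl | false | refl

  long⇒≢ : ∀ x → long x ≡ true → x ≢ v
  long⇒≢ x l refl = true≢false (begin
      true                                         ≡⟨ sym l ⟩
      nbr A w x ∧ not (nbr A x x) ∧ not (x == x)  ≡⟨ cong (λ b → nbr A w x ∧ not (nbr A x x) ∧ not b) (==-refl x) ⟩
      nbr A w x ∧ not (nbr A x x) ∧ false         ≡⟨ cong (nbr A w x ∧_) (BP.∧-zeroʳ _) ⟩
      nbr A w x ∧ false                           ≡⟨ BP.∧-zeroʳ _ ⟩
      false                                       ∎)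
    where
    true≢false : true ≢ false
    true≢false ()

  short-long-disjoint : ∀ x → short x ≡ true → long x ≡ true → ⊥
  short-long-disjoint x s l with nbr A v x | nbr A w x
  short-long-disjoint x () l | true  | true
  short-long-disjoint x s () | true  | false
  short-long-disjoint x () l | false | _

  hub≢X : ∀ {x} → x ≢ v → eqWV hub (X x) ≡ false
  hub≢X {x} x≢v rewrite ==-refl v | ==-refl w = ==-≢ (≢-sym x≢v)

  ZeroInside : (WV n → ℤ) → Set
  ZeroInside β = ∀ x → x ≢ v → (β (X x) ≡ Z.0ℤ) × (β (Y x) ≡ Z.0ℤ)

  UntouchedInside : List (Arc n) → Set
  UntouchedInside R = ∀ x → x ≢ v → Untouched R (X x) × Untouched R (Y x)

  eulerSum-chunk : ∀ x R β → (x ≢ v → Untouched R (X x) × Untouched R (Y x)) → ZeroInside β →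
    eulerSum (chunk x ++ R) β ≡ eulerSum R β + κ x * eulerSum R (β +∂ (hub , star x))
  eulerSum-chunk x R β unt β-inside with short x in s | long x in l
  ... | true  | true  = ⊥-elim (short-long-disjoint x s l)
  ... | false | false =
    solve 2 (λ a b → a := a :+ (con 0ℚ :- con 0ℚ) :* b) refl (eulerSum R β) (eulerSum R (β +∂ (hub , star x)))
  ... | true  | false = trans
    (eulerSum-series R β hub (X x) (star x) (proj₁ (unt x≢v)) (proj₁ (β-inside x x≢v)) (hub≢X x≢v) refl)
    (solve 2 (λ a b → a :+ b := a :+ (con 1ℚ :- con 0ℚ) :* b) refl (eulerSum R β) (eulerSum R (β +∂ (hub , star x))))
    where x≢v = short⇒≢ x s
  ... | false | true  = trans
    (eulerSum-series₃ R β hub (Y x) (X x) (star x) (proj₂ (unt x≢v)) (proj₁ (unt x≢v))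
      (proj₂ (β-inside x x≢v)) (proj₁ (β-inside x x≢v)) refl (hub≢X x≢v) refl refl refl)
    (solve 2 (λ a b → a :- b := a :+ (con 0ℚ :- con 1ℚ) :* b) refl (eulerSum R β) (eulerSum R (β +∂ (hub , star x))))
    where x≢v = long⇒≢ x l

  chunk-untouched : ∀ {x′ x} → x′ ≢ x → x ≢ v → Untouched (chunk x′) (X x) × Untouched (chunk x′) (Y x)
  chunk-untouched {x′} {x} x′≢x x≢v =
      AllP.++⁺ (All-guard⁺ (short x′) ((hub≢X x≢v , X≢X) All.∷ (X≢X , refl) All.∷ All.[]))
               (All-guard⁺ (long x′) ((hub≢X x≢v , refl) All.∷ (refl , X≢X) All.∷ (X≢X , refl) All.∷ All.[]))
    , AllP.++⁺ (All-guard⁺ (short x′) ((refl , refl) All.∷ (refl , refl) All.∷ All.[]))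
               (All-guard⁺ (long x′) ((refl , Y≢Y) All.∷ (Y≢Y , refl) All.∷ (refl , refl) All.∷ All.[]))
    where
    X≢X : eqWV (X x′) (X x) ≡ false
    X≢X rewrite ==-refl v | ==-refl w = ==-≢ x′≢x
    Y≢Y : eqWV (Y x′) (Y x) ≡ false
    Y≢Y rewrite ==-refl v | ==-refl w = ==-≢ x′≢x

  zeroInside-+∂ : ∀ β x → ZeroInside β → ZeroInside (β +∂ (hub , star x))
  zeroInside-+∂ β x β-inside x′ x′≢v =
      trans (+∂-away β hub (star x) (X x′) (hub≢X x′≢v) refl) (proj₁ (β-inside x′ x′≢v))
    , trans (+∂-away β hub (star x) (Y x′) refl refl) (proj₂ (β-inside x′ x′≢v))

  -- Taking the path of a chunk raises the hub value by one, and R does not touch the hub, so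
  -- only choices of paths that bring the hub value to exactly 0 contribute.
  module Chunks (R : List (Arc n)) (R-hub : Untouched R hub) (R-inside : UntouchedInside R) where

    chunks : List (Fin n) → List (Arc n)
    chunks xs = concatMap chunk xs ++ R

    chunks-untouched : ∀ {x xs} → All (x ≢_) xs → x ≢ v → Untouched (chunks xs) (X x) × Untouched (chunks xs) (Y x)
    chunks-untouched {x} {xs} x∉xs x≢v =
        AllP.++⁺ (All-concatMap⁺ chunk (λ x′∈xs → proj₁ (chunk-untouched (≢-sym (All.lookup x∉xs x′∈xs)) x≢v)))
                 (proj₁ (R-inside x x≢v))
      , AllP.++⁺ (All-concatMap⁺ chunk (λ x′∈xs → proj₂ (chunk-untouched (≢-sym (All.lookup x∉xs x′∈xs)) x≢v)))
                 (proj₂ (R-inside x x≢v))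

    eulerSum-chunks-∷ : ∀ x xs → All (x ≢_) xs → ∀ β → ZeroInside β →
      eulerSum (chunks (x ∷ xs)) β ≡ eulerSum (chunks xs) β + κ x * eulerSum (chunks xs) (β +∂ (hub , star x))
    eulerSum-chunks-∷ x xs x∉xs β β-inside = trans
      (cong (λ H → eulerSum H β) (LP.++-assoc (chunk x) (concatMap chunk xs) R))
      (eulerSum-chunk x (chunks xs) β (chunks-untouched x∉xs) β-inside)

    hub-+∂ : ∀ β x → (β +∂ (hub , star x)) hub ≡ β hub Z.+ Z.1ℤ
    hub-+∂ β x = +∂-source β hub (star x) refl

    eulerSum-chunks⁺ : ∀ xs → Unique xs → ∀ β k → β hub ≡ Z.+ suc k → ZeroInside β → eulerSum (chunks xs) β ≡ 0ℚ
    eulerSum-chunks⁺ []       _            β k βhub β-inside = eulerSum-untouched′ R β hub R-hub βhub (λ ())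
    eulerSum-chunks⁺ (x ∷ xs) (x∉xs ∷ uxs) β k βhub β-inside = begin
        eulerSum (chunks (x ∷ xs)) β
      ≡⟨ eulerSum-chunks-∷ x xs x∉xs β β-inside ⟩
        eulerSum (chunks xs) β + κ x * eulerSum (chunks xs) (β +∂ (hub , star x))
      ≡⟨ cong₂ (λ a b → a + κ x * b) (eulerSum-chunks⁺ xs uxs β k βhub β-inside)
           (eulerSum-chunks⁺ xs uxs (β +∂ (hub , star x)) (k N.+ 1)
             (trans (hub-+∂ β x) (cong (Z._+ Z.1ℤ) βhub)) (zeroInside-+∂ β x β-inside)) ⟩
        0ℚ + κ x * 0ℚ
      ≡⟨ trans (QP.+-identityˡ _) (QP.*-zeroʳ (κ x)) ⟩
        0ℚ ∎

    eulerSum-chunks⁰ : ∀ xs → Unique xs → ∀ β → β hub ≡ Z.0ℤ → ZeroInside β → eulerSum (chunks xs) β ≡ eulerSum R β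
    eulerSum-chunks⁰ []       _            β βhub β-inside = refl
    eulerSum-chunks⁰ (x ∷ xs) (x∉xs ∷ uxs) β βhub β-inside = begin
        eulerSum (chunks (x ∷ xs)) β
      ≡⟨ eulerSum-chunks-∷ x xs x∉xs β β-inside ⟩
        eulerSum (chunks xs) β + κ x * eulerSum (chunks xs) (β +∂ (hub , star x))
      ≡⟨ cong₂ (λ a b → a + κ x * b) (eulerSum-chunks⁰ xs uxs β βhub β-inside)
           (eulerSum-chunks⁺ xs uxs (β +∂ (hub , star x)) 0
             (trans (hub-+∂ β x) (cong (Z._+ Z.1ℤ) βhub)) (zeroInside-+∂ β x β-inside)) ⟩
        eulerSum R β + κ x * 0ℚ
      ≡⟨ trans (cong (eulerSum R β +_) (QP.*-zeroʳ (κ x))) (QP.+-identityʳ _) ⟩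
        eulerSum R β ∎

    eulerSum-chunks⁻ : ∀ xs → Unique xs → ∀ β → β hub ≡ Z.-1ℤ → ZeroInside β →
      eulerSum (chunks xs) β ≡ ∑[ x ← xs ] (κ x * eulerSum R (β +∂ (hub , star x)))
    eulerSum-chunks⁻ []       _            β βhub β-inside = eulerSum-untouched′ R β hub R-hub βhub (λ ())
    eulerSum-chunks⁻ (x ∷ xs) (x∉xs ∷ uxs) β βhub β-inside = begin
        eulerSum (chunks (x ∷ xs)) β
      ≡⟨ eulerSum-chunks-∷ x xs x∉xs β β-inside ⟩
        eulerSum (chunks xs) β + κ x * eulerSum (chunks xs) (β +∂ (hub , star x))
      ≡⟨ cong₂ (λ a b → a + κ x * b) (eulerSum-chunks⁻ xs uxs β βhub β-inside)
           (eulerSum-chunks⁰ xs uxs (β +∂ (hub , star x))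
             (trans (hub-+∂ β x) (cong (Z._+ Z.1ℤ) βhub)) (zeroInside-+∂ β x β-inside)) ⟩
        ∑[ y ← xs ] (κ y * eulerSum R (β +∂ (hub , star y))) + κ x * eulerSum R (β +∂ (hub , star x))
      ≡⟨ QP.+-comm (∑[ y ← xs ] (κ y * eulerSum R (β +∂ (hub , star y)))) _ ⟩
        ∑[ y ← x ∷ xs ] (κ y * eulerSum R (β +∂ (hub , star y))) ∎

  arcForm≡κ-at-v : ∀ x → A v w ≡ true →
    arcForm A v w x ≡ (if x == v then - 1ℚ else 0ℚ) + κ x
  arcForm≡κ-at-v x A-vw with x F.≟ v
  ... | yes refl rewrite nbr-irrefl x | A-vw | BP.∨-zeroʳ (A w x) = refl
  ... | no _ with nbr A v x | nbr A w x
  ...   | true  | true  = refl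
  ...   | true  | false = refl
  ...   | false | true  = refl
  ...   | false | false = refl

  ∑-arcForm : (g : Fin n → ℚ) → A v w ≡ true →
    ∑[ x ← allFin n ] (arcForm A v w x * g x) ≡ - g v + ∑[ x ← allFin n ] (κ x * g x)
  ∑-arcForm g A-vw = begin
      ∑[ x ← allFin n ] (arcForm A v w x * g x)
    ≡⟨ ∑-cong (allFin n) (λ x → trans (cong (_* g x) (arcForm≡κ-at-v x A-vw))
                                       (QP.*-distribʳ-+ (g x) (if x == v then - 1ℚ else 0ℚ) (κ x))) ⟩
      ∑[ x ← allFin n ] ((if x == v then - 1ℚ else 0ℚ) * g x + κ x * g x)
    ≡⟨ ∑-+ (allFin n) _ _ ⟩
      ∑[ x ← allFin n ] ((if x == v then - 1ℚ else 0ℚ) * g x) + ∑[ x ← allFin n ] (κ x * g x)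
    ≡⟨ cong (_+ ∑[ x ← allFin n ] (κ x * g x))
         (trans (∑-cong (allFin n) pick) (∑-indicator (- g v) (UP.allFin⁺ n) (∈-allFin v))) ⟩
      - g v + ∑[ x ← allFin n ] (κ x * g x) ∎
    where
    pick : ∀ x → (if x == v then - 1ℚ else 0ℚ) * g x ≡ (if x == v then - g v else 0ℚ)
    pick x with x F.≟ v
    ... | yes refl = solve 1 (λ y → (:- con 1ℚ) :* y := :- y) refl (g x)
    ... | no _ = QP.*-zeroˡ (g x)

  +∂-loop : ∀ (β : WV n → ℤ) p u → (β +∂ (p , p)) u ≡ β u
  +∂-loop β p u = trans (cong (λ z → β u Z.+ z) (ZP.+-inverseʳ (χ (eqWV p u)))) (ZP.+-identityʳ (β u))

  eulerSum-sector : ∀ R β → A v w ≡ true → Untouched R hub → UntouchedInside R → β hub ≡ Z.0ℤ → ZeroInside β →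
    eulerSum (sectorArcs A v w ++ R) β ≡ - ∑[ x ← allFin n ] (arcForm A v w x * eulerSum R (β +∂ (star v , star x)))
  eulerSum-sector R β A-vw R-hub R-inside βhub β-inside = begin
      eulerSum (chunks (allFin n)) β - eulerSum (chunks (allFin n)) β₁
    ≡⟨ cong₂ _-_ (eulerSum-chunks⁰ (allFin n) (UP.allFin⁺ n) β βhub β-inside)
                 (eulerSum-chunks⁻ (allFin n) (UP.allFin⁺ n) β₁ β₁hub inside₁) ⟩
      eulerSum R β - ∑[ x ← allFin n ] (κ x * eulerSum R (β₁ +∂ (hub , star x)))
    ≡⟨ cong₂ _-_ (eulerSum-cong R (λ u → sym (+∂-loop β (star v) u)))
                 (∑-cong (allFin n) (λ x → cong (κ x *_) (eulerSum-cong R (+∂-+∂ β (star v) hub (star x))))) ⟩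
      g v - ∑[ x ← allFin n ] (κ x * g x)
    ≡⟨ solve 2 (λ a s → a :- s := :- ((:- a) :+ s)) refl (g v) _ ⟩
      - (- g v + ∑[ x ← allFin n ] (κ x * g x))
    ≡⟨ cong -_ (sym (∑-arcForm g A-vw)) ⟩
      - ∑[ x ← allFin n ] (arcForm A v w x * g x) ∎
    where
    open Chunks R R-hub R-inside
    g : Fin n → ℚ
    g x = eulerSum R (β +∂ (star v , star x))
    β₁ = β +∂ (star v , hub)
    β₁hub : β₁ hub ≡ Z.-1ℤ
    β₁hub = trans (+∂-target β (star v) hub refl) (cong (Z._- Z.1ℤ) βhub)
    inside₁ : ZeroInside β₁
    inside₁ x x≢v = trans (+∂-away β (star v) hub (X x) refl (hub≢X x≢v)) (proj₁ (β-inside x x≢v))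
                  , trans (+∂-away β (star v) hub (Y x) refl refl) (proj₂ (β-inside x x≢v))

data SectorVertex {n : ℕ} (v w : Fin n) : WV n → Set where
  star : ∀ x → SectorVertex v w (star x)
  sec  : ∀ x → SectorVertex v w (sec v w x)
  ysec : ∀ x → SectorVertex v w (ysec v w x)

module Sectors {n : ℕ} (A : Fin n → Fin n → Bool) (A-irrefl : ∀ u → A u u ≡ false) where

  sectorArcs-endpoints : ∀ v w →
    All (λ a → SectorVertex v w (proj₁ a) × SectorVertex v w (proj₂ a)) (sectorArcs A v w)
  sectorArcs-endpoints v w = (star v , sec v) All.∷ All-concatMap⁺ (chunk A A-irrefl v w) {allFin n} (λ {x} _ →
    AllP.++⁺ (All-guard⁺ (short A A-irrefl v w x) ((sec v , sec x) All.∷ (sec x , star x) All.∷ All.[]))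
             (All-guard⁺ (long A A-irrefl v w x)
               ((sec v , ysec x) All.∷ (ysec x , sec x) All.∷ (sec x , star x) All.∷ All.[])))
    where open Sector using (chunk; short; long)

  private
    pair-≢ : ∀ {v′ w′ v w : Fin n} (r : Bool) → (v′ , w′) ≢ (v , w) → (v′ == v) ∧ (w′ == w) ∧ r ≡ false
    pair-≢ {v′} {w′} {v} {w} r ne with v′ F.≟ v | w′ F.≟ w
    ... | yes refl | yes refl = ⊥-elim (ne refl)
    ... | yes refl | no _     = refl
    ... | no _     | _        = refl

    away : ∀ {v′ w′ v w : Fin n} {p} → SectorVertex v′ w′ p → (v′ , w′) ≢ (v , w) →
           ∀ c → (eqWV p (sec v w c) ≡ false) × (eqWV p (ysec v w c) ≡ false)
    away (star _) ne c = refl , refl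
    away (sec _)  ne c = pair-≢ _ ne , refl
    away (ysec _) ne c = refl , pair-≢ _ ne

  sectorArcs-untouched : ∀ {v′ w′ v w} → (v′ , w′) ≢ (v , w) → ∀ c →
    Untouched (sectorArcs A v′ w′) (sec v w c) × Untouched (sectorArcs A v′ w′) (ysec v w c)
  sectorArcs-untouched {v′} {w′} ne c =
      All.map (λ (p , q) → proj₁ (away p ne c) , proj₁ (away q ne c)) (sectorArcs-endpoints v′ w′)
    , All.map (λ (p , q) → proj₂ (away p ne c) , proj₂ (away q ne c)) (sectorArcs-endpoints v′ w′)

  sectors : List (Fin n × Fin n) → List (Arc n)
  sectors = concatMap (λ (v , w) → sectorArcs A v w)

  sectors-untouched : ∀ {v w} as → All ((v , w) ≢_) as → ∀ c →
    Untouched (sectors as) (sec v w c) × Untouched (sectors as) (ysec v w c)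
  sectors-untouched []              _              c = All.[] , All.[]
  sectors-untouched ((v′ , w′) ∷ as) (ne All.∷ nes) c =
      AllP.++⁺ (proj₁ (sectorArcs-untouched (≢-sym ne) c)) (proj₁ (sectors-untouched as nes c))
    , AllP.++⁺ (proj₂ (sectorArcs-untouched (≢-sym ne) c)) (proj₂ (sectors-untouched as nes c))

  forms : List (Fin n × Fin n) → List (Fin n → ℚ)
  forms = map (λ (v , w) → arcForm A v w)

  tailCount : List (Fin n × Fin n) → Fin n → ℕ
  tailCount as u = count (λ a → proj₁ a == u) as

  exponent : List (Fin n × Fin n) → (WV n → ℤ) → Fin n → ℤ
  exponent as β u = Z.+ tailCount as u Z.+ β (star u)

  ZeroOnSectors : (WV n → ℤ) → Set
  ZeroOnSectors β = ∀ a b c → (β (sec a b c) ≡ Z.0ℤ) × (β (ysec a b c) ≡ Z.0ℤ)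

  exponent-+∂ : ∀ v w as β x u → exponent as (β +∂ (star v , star x)) u ≡ lower (exponent ((v , w) ∷ as) β) x u
  exponent-+∂ v w as β x u with u F.≟ x
  ... | yes refl = begin
      Z.+ t Z.+ (β (star u) Z.+ (χ (v == u) Z.- χ (u == u)))
    ≡⟨ cong (λ b → Z.+ t Z.+ (β (star u) Z.+ (χ (v == u) Z.- χ b))) (==-refl u) ⟩
      Z.+ t Z.+ (β (star u) Z.+ (χ (v == u) Z.- Z.1ℤ))
    ≡⟨ ZS.solve 3 (λ t b c → t ZS.:+ (b ZS.:+ (c ZS.:- ZS.con Z.1ℤ)) ZS.:= ((c ZS.:+ t) ZS.:+ b) ZS.:- ZS.con Z.1ℤ)
         refl (Z.+ t) (β (star u)) (χ (v == u)) ⟩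
      (χ (v == u) Z.+ Z.+ t) Z.+ β (star u) Z.- Z.1ℤ
    ≡⟨ cong (λ c → c Z.+ β (star u) Z.- Z.1ℤ) (sym (count-∷ (λ a → proj₁ a == u) (v , w) as)) ⟩
      exponent ((v , w) ∷ as) β u Z.- Z.1ℤ
    ≡⟨ sym (updateAt-updates u (exponent ((v , w) ∷ as) β)) ⟩
      lower (exponent ((v , w) ∷ as) β) u u ∎
    where t = tailCount as u
  ... | no u≢x = begin
      Z.+ t Z.+ (β (star u) Z.+ (χ (v == u) Z.- χ (x == u)))
    ≡⟨ cong (λ b → Z.+ t Z.+ (β (star u) Z.+ (χ (v == u) Z.- χ b))) (==-≢ (≢-sym u≢x)) ⟩
      Z.+ t Z.+ (β (star u) Z.+ (χ (v == u) Z.- Z.0ℤ))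
    ≡⟨ ZS.solve 3 (λ t b c → t ZS.:+ (b ZS.:+ (c ZS.:- ZS.con Z.0ℤ)) ZS.:= (c ZS.:+ t) ZS.:+ b)
         refl (Z.+ t) (β (star u)) (χ (v == u)) ⟩
      (χ (v == u) Z.+ Z.+ t) Z.+ β (star u)
    ≡⟨ cong (Z._+ β (star u)) (sym (count-∷ (λ a → proj₁ a == u) (v , w) as)) ⟩
      exponent ((v , w) ∷ as) β u
    ≡⟨ sym (updateAt-minimal u x (exponent ((v , w) ∷ as) β) u≢x) ⟩
      lower (exponent ((v , w) ∷ as) β) x u ∎
    where t = tailCount as u

  eulerSum-[] : ∀ β → ZeroOnSectors β → eulerSum [] β ≡ coeff [] (exponent [] β)
  eulerSum-[] β β-sectors = cong (if_then 1ℚ else 0ℚ) (begin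
      allB (isZero ∘ β) (map star (allFin n) ++ innerVertices)
    ≡⟨ allB-++ (isZero ∘ β) (map star (allFin n)) innerVertices ⟩
      allB (isZero ∘ β) (map star (allFin n)) ∧ allB (isZero ∘ β) innerVertices
    ≡⟨ cong₂ _∧_ (allB-map (isZero ∘ β) star (allFin n)) (allB-true (isZero ∘ β) inner≡0) ⟩
      allB (λ u → isZero (β (star u))) (allFin n) ∧ true
    ≡⟨ BP.∧-identityʳ _ ⟩
      allB (λ u → isZero (β (star u))) (allFin n)
    ≡⟨ allB-cong (allFin n) (λ u → cong isZero (sym (ZP.+-identityˡ (β (star u))))) ⟩
      allZero (exponent [] β) ∎)
    where
    innerVertices : List (WV n)
    innerVertices =
      concatMap (λ a → concatMap (λ b → concatMap (λ c → sec a b c ∷ ysec a b c ∷ []) (allFin n)) (allFin n)) (allFin n)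
    inner≡0 : All (λ u → isZero (β u) ≡ true) innerVertices
    inner≡0 =
      All-concatMap⁺ _ {allFin n} λ {a} _ →
      All-concatMap⁺ _ {allFin n} λ {b} _ →
      All-concatMap⁺ (λ c → sec a b c ∷ ysec a b c ∷ []) {allFin n} λ {c} _ →
      cong isZero (proj₁ (β-sectors a b c)) All.∷ cong isZero (proj₂ (β-sectors a b c)) All.∷ All.[]

  eulerSum-sectors : ∀ as → Unique as → All (λ (v , w) → A v w ≡ true) as → ∀ β → ZeroOnSectors β →
    eulerSum (sectors as) β ≡ sign (length as) * coeff (forms as) (exponent as β)
  eulerSum-sectors [] _ _ β β-sectors = trans (eulerSum-[] β β-sectors) (sym (QP.*-identityˡ _))
  eulerSum-sectors ((v , w) ∷ as) (vw∉as ∷ uas) (A-vw All.∷ A-as) β β-sectors = begin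
      eulerSum (sectorArcs A v w ++ sectors as) β
    ≡⟨ Sector.eulerSum-sector A A-irrefl v w (sectors as) β A-vw
         (proj₁ (sectors-untouched as vw∉as v)) (λ x _ → sectors-untouched as vw∉as x)
         (proj₁ (β-sectors v w v)) (λ x _ → β-sectors v w x) ⟩
      - ∑[ x ← allFin n ] (arcForm A v w x * eulerSum (sectors as) (β +∂ (star v , star x)))
    ≡⟨ cong -_ (∑-cong (allFin n) (λ x → cong (arcForm A v w x *_) (begin
         eulerSum (sectors as) (β +∂ (star v , star x))
       ≡⟨ eulerSum-sectors as uas A-as (β +∂ (star v , star x)) (β′-sectors x) ⟩
         σ * coeff (forms as) (exponent as (β +∂ (star v , star x)))
       ≡⟨ cong (σ *_) (coeff-cong (forms as) (exponent-+∂ v w as β x)) ⟩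
         σ * coeff (forms as) (lower γ x) ∎))) ⟩
      - ∑[ x ← allFin n ] (arcForm A v w x * (σ * coeff (forms as) (lower γ x)))
    ≡⟨ cong -_ (trans (∑-cong (allFin n) (λ x → solve 3 (λ k s c → k :* (s :* c) := s :* (k :* c)) refl (arcForm A v w x) σ _))
                      (∑-*ˡ (allFin n) σ _)) ⟩
      - (σ * coeff (forms ((v , w) ∷ as)) γ)
    ≡⟨ QP.neg-distribˡ-* σ _ ⟩
      - σ * coeff (forms ((v , w) ∷ as)) γ
    ≡⟨ cong (_* coeff (forms ((v , w) ∷ as)) γ) (sym (sign-suc (length as))) ⟩
      sign (length ((v , w) ∷ as)) * coeff (forms ((v , w) ∷ as)) γ ∎
    where
    σ = sign (length as)
    γ = exponent ((v , w) ∷ as) β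
    β′-sectors : ∀ x → ZeroOnSectors (β +∂ (star v , star x))
    β′-sectors x a b c = trans (+∂-away β (star v) (star x) (sec a b c) refl refl) (proj₁ (β-sectors a b c))
                       , trans (+∂-away β (star v) (star x) (ysec a b c) refl refl) (proj₂ (β-sectors a b c))

  isArc? : Decidable (λ ((v , w) : Fin n × Fin n) → A v w ≡ true)
  isArc? (v , w) = A v w BP.≟ true

  private
    row : Fin n → List (Fin n × Fin n)
    row v = filter isArc? (map (v ,_) (allFin n))

    rows : List (Fin n) → List (Fin n × Fin n)
    rows xs = filter isArc? (cartesianProduct xs (allFin n))

  arcs : List (Fin n × Fin n)
  arcs = rows (allFin n)

  arcs-unique : Unique arcs
  arcs-unique = UP.filter⁺ isArc? (UP.cartesianProduct⁺ (UP.allFin⁺ n) (UP.allFin⁺ n))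

  arcs-arcs : All (λ (v , w) → A v w ≡ true) arcs
  arcs-arcs = AllP.all-filter isArc? (cartesianProduct (allFin n) (allFin n))

  ∈-arcs : ∀ {v w} → A v w ≡ true → (v , w) ∈ arcs
  ∈-arcs A-vw = ∈-filter⁺ isArc? (∈-cartesianProduct⁺ (∈-allFin _) (∈-allFin _)) A-vw

  W≡sectors-arcs : W A ≡ sectors arcs
  W≡sectors-arcs = sym (sectors-rows (allFin n))
    where
    sectors-row : ∀ v ys → sectors (filter isArc? (map (v ,_) ys))
                           ≡ concatMap (λ w → guard (A v w) (sectorArcs A v w)) ys
    sectors-row v []       = refl
    sectors-row v (w ∷ ys) with A v w
    ... | true  = cong (sectorArcs A v w ++_) (sectors-row v ys)
    ... | false = sectors-row v ys
    sectors-rows : ∀ xs → sectors (rows xs)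
                          ≡ concatMap (λ v → concatMap (λ w → guard (A v w) (sectorArcs A v w)) (allFin n)) xs
    sectors-rows []       = refl
    sectors-rows (v ∷ xs) = begin
        sectors (filter isArc? (map (v ,_) (allFin n) ++ cartesianProduct xs (allFin n)))
      ≡⟨ cong sectors (LP.filter-++ isArc? (map (v ,_) (allFin n)) _) ⟩
        sectors (row v ++ rows xs)
      ≡⟨ LP.concatMap-++ _ (row v) (rows xs) ⟩
        sectors (row v) ++ sectors (rows xs)
      ≡⟨ cong₂ _++_ (sectors-row v (allFin n)) (sectors-rows xs) ⟩
        concatMap (λ w → guard (A v w) (sectorArcs A v w)) (allFin n)
          ++ concatMap (λ v → concatMap (λ w → guard (A v w) (sectorArcs A v w)) (allFin n)) xs ∎

  private
    count-++ : {B : Set} (p : B → Bool) (xs ys : List B) → count p (xs ++ ys) ≡ count p xs N.+ count p ys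
    count-++ p []       ys = refl
    count-++ p (x ∷ xs) ys with p x
    ... | true  = cong suc (count-++ p xs ys)
    ... | false = count-++ p xs ys

    tailCount-rows-∷ : ∀ x xs u → tailCount (rows (x ∷ xs)) u ≡ tailCount (row x) u N.+ tailCount (rows xs) u
    tailCount-rows-∷ x xs u = trans
      (cong (λ as → tailCount as u) (LP.filter-++ isArc? (map (x ,_) (allFin n)) _))
      (count-++ _ (row x) (rows xs))

    row-own : ∀ v ys → tailCount (filter isArc? (map (v ,_) ys)) v ≡ count (A v) ys
    row-own v []       = refl
    row-own v (w ∷ ys) with A v w
    ... | true  rewrite ==-refl v = cong suc (row-own v ys)
    ... | false = row-own v ys

    row-other : ∀ {v u} → v ≢ u → ∀ ys → tailCount (filter isArc? (map (v ,_) ys)) u ≡ 0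
    row-other v≢u []       = refl
    row-other {v} {u} v≢u (w ∷ ys) with A v w
    ... | true  rewrite ==-≢ v≢u = row-other v≢u ys
    ... | false = row-other v≢u ys

    rows-other : ∀ {u} xs → All (u ≢_) xs → tailCount (rows xs) u ≡ 0
    rows-other     []       _                = refl
    rows-other {u} (x ∷ xs) (u≢x All.∷ u∉xs) = trans (tailCount-rows-∷ x xs u)
      (cong₂ N._+_ (row-other (≢-sym u≢x) (allFin n)) (rows-other xs u∉xs))

    rows-own : ∀ {u} xs → Unique xs → u ∈ xs → tailCount (rows xs) u ≡ outdeg A u
    rows-own {u} (x ∷ xs) (x∉xs ∷ uxs) (here refl) = trans (tailCount-rows-∷ x xs u)
      (trans (cong₂ N._+_ (row-own u (allFin n)) (rows-other xs x∉xs)) (NP.+-identityʳ _))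
    rows-own {u} (x ∷ xs) (x∉xs ∷ uxs) (there u∈xs) = trans (tailCount-rows-∷ x xs u)
      (cong₂ N._+_ (row-other (All.lookup x∉xs u∈xs) (allFin n)) (rows-own xs uxs u∈xs))

  tailCount-arcs : ∀ u → tailCount arcs u ≡ outdeg A u
  tailCount-arcs u = rows-own (allFin n) (UP.allFin⁺ n) (∈-allFin u)

  length≡totalDegree-tailCount : ∀ as → length as ≡ totalDegree (tailCount as)
  length≡totalDegree-tailCount []             = sym (totalDegree-0 {n})
  length≡totalDegree-tailCount ((v , w) ∷ as) = begin
      suc (length as)                           ≡⟨ cong suc (length≡totalDegree-tailCount as) ⟩
      suc (totalDegree (tailCount as))          ≡⟨ sym (totalDegree-raise (tailCount as) v) ⟩
      totalDegree (updateAt (tailCount as) v suc) ≡⟨ totalDegree-cong raise ⟩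
      totalDegree (tailCount ((v , w) ∷ as))    ∎
    where
    raise : ∀ u → updateAt (tailCount as) v suc u ≡ tailCount ((v , w) ∷ as) u
    raise u with u F.≟ v
    ... | yes refl rewrite ==-refl u = updateAt-updates u (tailCount as)
    ... | no u≢v   rewrite ==-≢ (≢-sym u≢v) = updateAt-minimal u v (tailCount as) u≢v

  length-arcs : length arcs ≡ totalDegree (outdeg A)
  length-arcs = trans (length≡totalDegree-tailCount arcs) (totalDegree-cong tailCount-arcs)

  eulerSum-W : eulerSum (W A) (λ _ → Z.0ℤ) ≡ sign (length arcs) * coeff (forms arcs) (Z.+_ ∘ outdeg A)
  eulerSum-W = begin
      eulerSum (W A) (λ _ → Z.0ℤ)
    ≡⟨ cong (λ H → eulerSum H (λ _ → Z.0ℤ)) W≡sectors-arcs ⟩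
      eulerSum (sectors arcs) (λ _ → Z.0ℤ)
    ≡⟨ eulerSum-sectors arcs arcs-unique arcs-arcs (λ _ → Z.0ℤ) (λ _ _ _ → refl , refl) ⟩
      sign (length arcs) * coeff (forms arcs) (exponent arcs (λ _ → Z.0ℤ))
    ≡⟨ cong (sign (length arcs) *_) (coeff-cong (forms arcs) (λ u →
         trans (ZP.+-identityʳ _) (cong Z.+_ (tailCount-arcs u)))) ⟩
      sign (length arcs) * coeff (forms arcs) (Z.+_ ∘ outdeg A) ∎

  EE≢EO⇒coeff≢0 : EE (W A) ≢ EO (W A) → coeff (forms arcs) (Z.+_ ∘ outdeg A) ≢ 0ℚ
  EE≢EO⇒coeff≢0 EE≢EO coeff≡0 = EE≢EO (ι-injective _ _ (x∙y⁻¹≈ε⇒x≈y _ _ (begin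
    ι (EE (W A)) - ι (EO (W A))                             ≡⟨ EE-EO≡eulerSum (W A) ⟩
    eulerSum (W A) (λ _ → Z.0ℤ)                             ≡⟨ eulerSum-W ⟩
    sign (length arcs) * coeff (forms arcs) (Z.+_ ∘ outdeg A) ≡⟨ cong (sign (length arcs) *_) coeff≡0 ⟩
    sign (length arcs) * 0ℚ                                 ≡⟨ QP.*-zeroʳ (sign (length arcs)) ⟩
    0ℚ                                                      ∎)))

module _ {n : ℕ} (G : SimpleGraph n) (D : Orientation G) where

  orientation-irrefl : ∀ u → A D u u ≡ false
  orientation-irrefl u with A D u u in A-uu
  ... | false = refl
  ... | true with () ← trans (sym (irrefl G u)) (arc⇒edge D u u A-uu)

  nbr≡E : ∀ v x → nbr (A D) v x ≡ E G v x
  nbr≡E v x with E G v x in E-vx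
  ... | true with edge⇒arc D v x E-vx
  ...   | inj₁ A-vx rewrite A-vx = refl
  ...   | inj₂ A-xv rewrite A-xv = BP.∨-zeroʳ (A D v x)
  nbr≡E v x | false with A D v x in A-vx | A D x v in A-xv
  ... | true  | _     with () ← trans (sym E-vx) (arc⇒edge D v x A-vx)
  ... | false | true  with () ← trans (sym E-vx) (trans (SimpleGraph.sym G v x) (arc⇒edge D x v A-xv))
  ... | false | false = refl

  ι-colorSum : ∀ ℓ v → ι (colorSum G ℓ v) ≡ ∑[ x ← allFin n ] (iverson (E G v x) * ι (ℓ x))
  ι-colorSum ℓ v = go (allFin n)
    where
    go : ∀ xs → ι (sum (map ℓ (filter (λ u → E G v u BP.≟ true) xs))) ≡ ∑[ x ← xs ] (iverson (E G v x) * ι (ℓ x))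
    go []       = refl
    go (x ∷ xs) with E G v x
    ... | true  = trans (ι-+ (ℓ x) _) (cong₂ _+_ (sym (QP.*-identityˡ (ι (ℓ x)))) (go xs))
    ... | false = trans (go xs) (trans (sym (QP.+-identityˡ _)) (cong (_+ _) (sym (QP.*-zeroˡ (ι (ℓ x))))))

  linForm-arcForm : ∀ ℓ v w → linForm (arcForm (A D) v w) ℓ ≡ ι (colorSum G ℓ v) - ι (colorSum G ℓ w)
  linForm-arcForm ℓ v w = begin
      ∑[ x ← allFin n ] ((iverson (nbr (A D) v x) - iverson (nbr (A D) w x)) * ι (ℓ x))
    ≡⟨ ∑-cong (allFin n) (λ x → begin
         (iverson (nbr (A D) v x) - iverson (nbr (A D) w x)) * ι (ℓ x)
       ≡⟨ cong₂ (λ p q → (iverson p - iverson q) * ι (ℓ x)) (nbr≡E v x) (nbr≡E w x) ⟩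
         (iverson (E G v x) - iverson (E G w x)) * ι (ℓ x)
       ≡⟨ solve 3 (λ a b c → (a :- b) :* c := a :* c :+ (:- (b :* c)))
            refl (iverson (E G v x)) (iverson (E G w x)) (ι (ℓ x)) ⟩
         iverson (E G v x) * ι (ℓ x) + - (iverson (E G w x) * ι (ℓ x)) ∎) ⟩
      ∑[ x ← allFin n ] (iverson (E G v x) * ι (ℓ x) + - (iverson (E G w x) * ι (ℓ x)))
    ≡⟨ ∑-+ (allFin n) _ _ ⟩
      ∑[ x ← allFin n ] (iverson (E G v x) * ι (ℓ x)) + ∑[ x ← allFin n ] (- (iverson (E G w x) * ι (ℓ x)))
    ≡⟨ cong₂ _+_ (sym (ι-colorSum ℓ v)) (trans (∑-neg (allFin n) _) (cong -_ (sym (ι-colorSum ℓ w)))) ⟩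
      ι (colorSum G ℓ v) - ι (colorSum G ℓ w) ∎

  open Sectors (A D) orientation-irrefl using (arcs; forms; ∈-arcs)

  ∏≢0⇒proper : ∀ ℓ → ∏[ k ← forms arcs ] linForm k ℓ ≢ 0ℚ →
               ∀ u v → E G u v ≡ true → colorSum G ℓ u ≢ colorSum G ℓ v
  ∏≢0⇒proper ℓ ∏≢0 u v E-uv = [ arc-proper , (λ A-vu → arc-proper A-vu ∘ sym) ]′ (edge⇒arc D u v E-uv)
    where
    arc-proper : ∀ {v w} → A D v w ≡ true → colorSum G ℓ v ≢ colorSum G ℓ w
    arc-proper {v} {w} A-vw cv≡cw = ∏-nonZero (forms arcs) (λ k → linForm k ℓ) ∏≢0 (∈-map⁺ _ (∈-arcs A-vw))
      (trans (linForm-arcForm ℓ v w)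
        (trans (cong (λ c → ι c - ι (colorSum G ℓ w)) cv≡cw) (QP.+-inverseʳ (ι (colorSum G ℓ w)))))

mainTheorem1 : (n : ℕ) (G : SimpleGraph n) (D : Orientation G)
    (L : Fin n → List ℕ) →
    (∀ v → Unique (L v)) →
    (∀ v → length (L v) ≡ suc (outdeg (A D) v)) →
    (∀ v → All (0 <_) (L v)) →
    EE (W (A D)) ≢ EO (W (A D)) →
    Σ (Fin n → ℕ) (λ ℓ → IsAdditiveColoring G ℓ × (∀ v → ℓ v ∈ L v))
mainTheorem1 n G D L L-unique L-length L-positive EE≢EO =
  let ℓ , ℓ∈L , ∏≢0 = gridPoint
  in  ℓ , ((λ v → All.lookup (L-positive v) (ℓ∈L v)) , ∏≢0⇒proper G D ℓ ∏≢0) , ℓ∈L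
  where
  open Sectors (A D) (orientation-irrefl G D)
  open Nullstellensatz L (outdeg (A D)) L-unique L-length

  gridPoint : Σ (Fin n → ℕ) (λ ℓ → (∀ v → ℓ v ∈ L v) × ∏[ k ← forms arcs ] linForm k ℓ ≢ 0ℚ)
  gridPoint = nullstellensatz (forms arcs) (trans (LP.length-map _ arcs) length-arcs) (EE≢EO⇒coeff≢0 EE≢EO)
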